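{- Let $D=\mathbb F_q$ be the finite field with $q$ elements and consider the Coefficient-Choosing Game with parameters $\mathbb F_q$ and degree $d\ge 2$. (1) If $d\ge 4$ or $d=2$, the player who makes the last play has a winning strategy. (2) If $d=3$ and the characteristic of $\mathbb F_q$ is $3$, Wanda has a winning strategy (regardless of who is Player I). (3) If $d=3$ and the characteristic of $\mathbb F_q$ is not $3$, the player who makes the last play has a winning strategy.
   Context: The Coefficient-Choosing Game with parameters an integral domain $D$ and a degree $d\ge 2$: one of two players, Wanda or Nora, is designated Player I and the other Player II. Starting with Player I, the players alternately choose the coefficients $a_0,\dots,a_d\in D$ of a polynomial $f(x)=a_dx^d+\cdots+a_1x+a_0$; on each turn the player picks any not-yet-chosen index $i$ (the order is not predetermined) and a value $a_i\in D$, subject to the rule that $a_d\neq 0$ and $a_0\neq 0$. When all $d+1$ coefficients are chosen, Wanda wins if $f$ has a root in the field of fractions of $D$, and Nora wins otherwise. "A player wins" means that player has a strategy that wins no matter how the other plays. -}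

module Defs where

open import Level using (Level; _⊔_)
open import Algebra.Bundles using (CommutativeRing)
open import Data.Nat using (ℕ; zero; suc; _<_)
open import Data.Fin using (Fin; toℕ)
import Data.Fin
open import Data.Fin.Base using () renaming (zero to fzero; suc to fsuc)
open import Data.Maybe using (Maybe; just; nothing)
open import Data.Product using (Σ; ∃; _×_; _,_)
open import Relation.Nullary using (¬_)
open import Relation.Binary.PropositionalEquality using (_≡_; _≢_)
open import Relation.Binary.Bundles using (Setoid)
open import Function.Bundles using (Inverse)
import Relation.Binary.PropositionalEquality as P

record Field (c ℓ : Level) : Set (Level.suc (c ⊔ ℓ)) where
  field
    commutativeRing : CommutativeRing c ℓ
  open CommutativeRing commutativeRing public
  field
    0≉1     : ¬ (0# ≈ 1#)
    inverse : ∀ x → ¬ (x ≈ 0#) → ∃ λ y → (x * y) ≈ 1#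

record FiniteField (c ℓ : Level) (q : ℕ) : Set (Level.suc (c ⊔ ℓ)) where
  field
    field' : Field c ℓ
  open Field field' public
  field
    enumeration : Inverse setoid (P.setoid (Fin q))

module _ {c ℓ : Level} (F : Field c ℓ) where
  open Field F

  natMul : ℕ → Carrier
  natMul zero    = 0#
  natMul (suc n) = 1# + natMul n

  HasCharacteristic : ℕ → Set ℓ
  HasCharacteristic p =
    (0 < p) × (natMul p ≈ 0#) × (∀ m → 0 < m → m < p → ¬ (natMul m ≈ 0#))

  pow : Carrier → ℕ → Carrier
  pow x zero    = 1#
  pow x (suc n) = x * pow x n

  sumFin : (n : ℕ) → (Fin n → Carrier) → Carrier
  sumFin zero    b = 0#
  sumFin (suc n) b = b fzero + sumFin n (λ i → b (fsuc i))

  evalPoly : (d : ℕ) → (Fin (suc d) → Carrier) → Carrier → Carrier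
  evalPoly d a x = sumFin (suc d) (λ i → a i * pow x (toℕ i))

  -- f has a root in F (F is its own field of fractions)
  HasRoot : (d : ℕ) → (Fin (suc d) → Carrier) → Set (c ⊔ ℓ)
  HasRoot d a = ∃ λ x → evalPoly d a x ≈ 0#

data Player : Set where
  Wanda Nora : Player

other : Player → Player
other Wanda = Nora
other Nora  = Wanda

-- Player I makes moves 1,3,5,...; there are d+1 moves in total.
-- mover playerI n = the player making move number n+1 (moves alternate);
-- the last move is move number d+1.
mover : (playerI : Player) → ℕ → Player
mover playerI zero    = playerI
mover playerI (suc n) = other (mover playerI n)

lastPlayer : (playerI : Player) → (d : ℕ) → Player
lastPlayer playerI d = mover playerI d

module Game {c ℓ : Level} (F : Field c ℓ) (d : ℕ) where
  open Field F

  Position : Set c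
  Position = Fin (suc d) → Maybe Carrier

  start : Position
  start _ = nothing

  set : Position → Fin (suc d) → Carrier → Position
  set pos i a j with i Data.Fin.≟ j
  ... | Relation.Nullary.yes _ = just a
  ... | Relation.Nullary.no  _ = pos j

  Legal : Position → Fin (suc d) → Carrier → Set (c ⊔ ℓ)
  Legal pos i a =
    (pos i ≡ nothing) × (toℕ i ≡ d → ¬ (a ≈ 0#)) × (toℕ i ≡ 0 → ¬ (a ≈ 0#))

  Complete : Position → Set c
  Complete pos = ∀ i → ∃ λ a → pos i ≡ just a

  WinsAt : Player → Position → Set (c ⊔ ℓ)
  WinsAt Wanda pos = ∃ λ a → (∀ i → pos i ≡ just (a i)) × HasRoot F d a
  WinsAt Nora  pos = ∀ a → (∀ i → pos i ≡ just (a i)) → ¬ HasRoot F d a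

  -- Wins P t pos : player P has a winning strategy from position pos
  -- when it is player t's turn to move.
  data Wins (P : Player) : Player → Position → Set (c ⊔ ℓ) where
    finished : ∀ {t pos} → Complete pos → WinsAt P pos → Wins P t pos
    myMove   : ∀ {t pos} → t ≡ P → (i : Fin (suc d)) (a : Carrier) →
               Legal pos i a → Wins P (other t) (set pos i a) → Wins P t pos
    theirMove : ∀ {t pos} → t ≢ P → ¬ Complete pos →
               (∀ i a → Legal pos i a → Wins P (other t) (set pos i a)) →
               Wins P t pos

  HasWinningStrategy : (P playerI : Player) → Set (c ⊔ ℓ)
  HasWinningStrategy P playerI = Wins P playerI start

module Submission where

-- The proof is built from:
--  * algebra of a finite field F: pigeonhole (an injective map F → F is
--    onto; a map identifying two points misses a value), and the maps
--    u ↦ B u + C u² and u ↦ B u + A u² + C u³, which decide the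
--    endgames on a₀ and a_d (whether the constant term can be chosen to
--    avoid a root is a question of injectivity of the rest);
--  * the final move on a middle coefficient: Wanda sets f(1) = 0, Nora
--    avoids the at most q - 1 values -rest(x)/xⁱ with x ≉ 0;
--  * d ≥ 4: the last mover fills both ends first (FillEndsFirst), so the
--    last hole is a middle one;
--  * d = 2 and d = 3: explicit strategies (Wanda pairs coefficients so
--    that f(1) = 0; Nora forces a non-injective cubic part; in
--    characteristic 3 Wanda makes it injective via u ↦ u³).

open import Defs
open import Level using (Level)
open import Data.Nat using (ℕ; _≤_)
open import Data.Product using (_×_)
open import Data.Sum using (_⊎_)
open import Relation.Nullary using (¬_)
open import Relation.Binary.PropositionalEquality using (_≡_)

open import Level using (_⊔_)
open import Algebra.Bundles using (CommutativeRing)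
open import Data.Nat as ℕ using (zero; suc; z≤n; s≤s)
import Data.Nat.Properties as ℕP
open import Data.Integer as ℤ using (ℤ; +_; -[1+_])
import Data.Integer.Properties as ℤP
import Data.Sign as Sign
open import Data.Fin using (Fin; toℕ; fromℕ; punchOut) renaming (zero to fzero; suc to fsuc)
import Data.Fin.Properties as FinP
open import Data.Maybe using (Maybe; just; nothing)
import Data.Maybe.Properties as MaybeP
open import Data.Product using (∃; _,_; proj₁; proj₂)
open import Data.Sum using (inj₁; inj₂)
open import Data.Empty using (⊥; ⊥-elim)
open import Relation.Nullary using (yes; no; Dec)
open import Relation.Nullary.Decidable using (map′)
open import Relation.Binary.PropositionalEquality as P using (_≢_)
open import Function.Bundles using (Inverse)
import Algebra.Solver.Ring
open import Algebra.Solver.Ring.AlmostCommutativeRing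
  using (AlmostCommutativeRing; fromCommutativeRing; _-Raw-AlmostCommutative⟶_)

-- The standard library's solver needs a homomorphism from
-- a coefficient ring with (weakly) decidable equality; ℤ → R, k ↦ k·1,
-- is such a homomorphism for every commutative ring R.

module IntegerCoefficients {c ℓ : Level} (R : CommutativeRing c ℓ) where
  open CommutativeRing R
  open import Relation.Binary.Reasoning.Setoid setoid
  open import Algebra.Properties.Semiring.Mult.TCOptimised semiring
    using (×-homo-+; ×1-homo-*) renaming (_×_ to _×′_)
  open import Algebra.Properties.Ring ring using (-‿distribˡ-*; -‿distribʳ-*)
  open import Algebra.Properties.AbelianGroup +-abelianGroup using (⁻¹-∙-comm)
  open import Algebra.Properties.Group +-group using (ε⁻¹≈ε; ⁻¹-involutive)

  -- n·1 (the type-checking-optimised multiple, so that 1·1 is 1#)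
  N : ℕ → Carrier
  N n = n ×′ 1#

  N-suc : ∀ n → N (suc n) ≈ 1# + N n
  N-suc n = ×-homo-+ 1# 1 n

  ι : ℤ → Carrier
  ι (+ n)    = N n
  ι -[1+ n ] = - N (suc n)

  ι-⊖ : ∀ m n → ι (m ℤ.⊖ n) ≈ N m - N n
  ι-⊖ m zero = sym (trans (+-congˡ ε⁻¹≈ε) (+-identityʳ _))
  ι-⊖ zero (suc n) = sym (+-identityˡ _)
  ι-⊖ (suc m) (suc n) = begin
    ι (suc m ℤ.⊖ suc n)      ≡⟨ P.cong ι (ℤP.[1+m]⊖[1+n]≡m⊖n m n) ⟩
    ι (m ℤ.⊖ n)              ≈⟨ ι-⊖ m n ⟩
    N m - N n                ≈⟨ cancel ⟨
    (1# + N m) - (1# + N n)  ≈⟨ +-cong (N-suc m) (-‿cong (N-suc n)) ⟨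
    N (suc m) - N (suc n)    ∎
    where
    cancel : (1# + N m) - (1# + N n) ≈ N m - N n
    cancel = begin
      (1# + N m) + - (1# + N n)    ≈⟨ +-cong (+-comm _ _) (⁻¹-∙-comm _ _) ⟨
      (N m + 1#) + (- 1# + - N n)  ≈⟨ +-assoc _ _ _ ⟩
      N m + (1# + (- 1# + - N n))  ≈⟨ +-congˡ (+-assoc _ _ _) ⟨
      N m + ((1# - 1#) + - N n)    ≈⟨ +-congˡ (+-congʳ (-‿inverseʳ _)) ⟩
      N m + (0# + - N n)           ≈⟨ +-congˡ (+-identityˡ _) ⟩
      N m - N n                    ∎

  ι-+ : ∀ i j → ι (i ℤ.+ j) ≈ ι i + ι j
  ι-+ (+ m) (+ n) = ×-homo-+ 1# m n
  ι-+ (+ m) -[1+ n ] = ι-⊖ m (suc n)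
  ι-+ -[1+ m ] (+ n) = trans (ι-⊖ n (suc m)) (+-comm _ _)
  ι-+ -[1+ m ] -[1+ n ] = begin
    - N (suc (suc (m ℕ.+ n)))  ≡⟨ P.cong (λ k → - N k) (P.sym (ℕP.+-suc (suc m) n)) ⟩
    - N (suc m ℕ.+ suc n)      ≈⟨ -‿cong (×-homo-+ 1# (suc m) (suc n)) ⟩
    - (N (suc m) + N (suc n))  ≈⟨ ⁻¹-∙-comm _ _ ⟨
    - N (suc m) + - N (suc n)  ∎

  S : Sign.Sign → Carrier
  S Sign.+ = 1#
  S Sign.- = - 1#

  S-* : ∀ s t → S (s Sign.* t) ≈ S s * S t
  S-* Sign.+ t = sym (*-identityˡ _)
  S-* Sign.- Sign.+ = sym (*-identityʳ _)
  S-* Sign.- Sign.- = begin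
    1#            ≈⟨ ⁻¹-involutive _ ⟨
    - - 1#        ≈⟨ -‿cong (*-identityʳ _) ⟨
    - (- 1# * 1#) ≈⟨ -‿distribʳ-* _ _ ⟩
    - 1# * - 1#   ∎

  ι-◃ : ∀ s n → ι (s ℤ.◃ n) ≈ S s * N n
  ι-◃ s zero = sym (zeroʳ _)
  ι-◃ Sign.+ (suc n) = sym (*-identityˡ _)
  ι-◃ Sign.- (suc n) = trans (-‿cong (sym (*-identityˡ _))) (-‿distribˡ-* _ _)

  ι-sign : ∀ i → ι i ≈ S (ℤ.sign i) * N ℤ.∣ i ∣
  ι-sign i = P.subst (λ k → ι k ≈ S (ℤ.sign i) * N ℤ.∣ i ∣) (ℤP.◃-inverse i)
                     (ι-◃ (ℤ.sign i) ℤ.∣ i ∣)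

  ι-* : ∀ i j → ι (i ℤ.* j) ≈ ι i * ι j
  ι-* i j = begin
    ι (si′ Sign.* sj′ ℤ.◃ ℤ.∣ i ∣ ℕ.* ℤ.∣ j ∣)  ≈⟨ ι-◃ (si′ Sign.* sj′) (ℤ.∣ i ∣ ℕ.* ℤ.∣ j ∣) ⟩
    S (si′ Sign.* sj′) * N (ℤ.∣ i ∣ ℕ.* ℤ.∣ j ∣) ≈⟨ *-cong (S-* si′ sj′) (×1-homo-* ℤ.∣ i ∣ ℤ.∣ j ∣) ⟩
    (si * sj) * (ni * nj)                      ≈⟨ interchange ⟩
    (si * ni) * (sj * nj)                      ≈⟨ *-cong (ι-sign i) (ι-sign j) ⟨
    ι i * ι j                                  ∎
    where
    si′ = ℤ.sign i
    sj′ = ℤ.sign j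
    si = S si′
    sj = S sj′
    ni = N ℤ.∣ i ∣
    nj = N ℤ.∣ j ∣
    interchange : (si * sj) * (ni * nj) ≈ (si * ni) * (sj * nj)
    interchange = begin
      (si * sj) * (ni * nj) ≈⟨ *-assoc _ _ _ ⟩
      si * (sj * (ni * nj)) ≈⟨ *-congˡ (*-assoc _ _ _) ⟨
      si * ((sj * ni) * nj) ≈⟨ *-congˡ (*-congʳ (*-comm _ _)) ⟩
      si * ((ni * sj) * nj) ≈⟨ *-congˡ (*-assoc _ _ _) ⟩
      si * (ni * (sj * nj)) ≈⟨ *-assoc _ _ _ ⟨
      (si * ni) * (sj * nj) ∎

  ι-neg : ∀ i → ι (ℤ.- i) ≈ - ι i
  ι-neg (+ zero) = sym ε⁻¹≈ε
  ι-neg (+ suc n) = refl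
  ι-neg -[1+ n ] = sym (⁻¹-involutive _)

  ι-homomorphism : ℤ.+-*-rawRing -Raw-AlmostCommutative⟶ fromCommutativeRing R
  ι-homomorphism = record
    { ⟦_⟧ = ι ; +-homo = ι-+ ; *-homo = ι-* ; -‿homo = ι-neg
    ; 0-homo = refl ; 1-homo = refl }

  ι-weaklyDecidable : ∀ i j → Maybe (ι i ≈ ι j)
  ι-weaklyDecidable i j with i ℤ.≟ j
  ... | yes P.refl = just refl
  ... | no _ = nothing

  open Algebra.Solver.Ring ℤ.+-*-rawRing (fromCommutativeRing R) ι-homomorphism ι-weaklyDecidable
    public using (solve; _:=_; _:+_; _:*_; _:-_; :-_; con)

injective⇒surjective : ∀ {n} (f : Fin n → Fin n) → (∀ {i j} → f i ≡ f j → i ≡ j) →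
                       ∀ y → ∃ λ i → f i ≡ y
injective⇒surjective {zero} f inj ()
injective⇒surjective {suc m} f inj y with FinP.any? (λ i → f i FinP.≟ y)
... | yes hit = hit
... | no miss = ⊥-elim (FinP.<⇒≢ i<j (inj (FinP.punchOut-injective (avoids i) (avoids j) gi≡gj)))
  where
  avoids : ∀ i → y ≢ f i
  avoids i e = miss (i , P.sym e)
  -- f misses y, so it factors through the m-element set Fin (suc m) ∖ {y}
  g : Fin (suc m) → Fin m
  g i = punchOut (avoids i)
  collision = FinP.pigeonhole (ℕP.n<1+n m) g
  i = proj₁ collision
  j = proj₁ (proj₂ collision)
  i<j = proj₁ (proj₂ (proj₂ collision))
  gi≡gj = proj₂ (proj₂ (proj₂ collision))

module FieldFacts {c ℓ : Level} {q : ℕ} (F : FiniteField c ℓ q) where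
  open FiniteField F public
  open Inverse enumeration using (to; from; to-cong; from-cong; inverseˡ; inverseʳ)
  open import Relation.Binary.Reasoning.Setoid setoid
  open IntegerCoefficients commutativeRing public using (solve; _:=_; _:+_; _:*_; _:-_; :-_; con; N; N-suc)
  open import Algebra.Properties.Group +-group public
    using (ε⁻¹≈ε; ⁻¹-involutive; ⁻¹-injective; inverseˡ-unique; x∙y⁻¹≈ε⇒x≈y; x≈y⇒x∙y⁻¹≈ε)

  from-to : ∀ x → from (to x) ≈ x
  from-to x = inverseʳ P.refl

  to-from : ∀ i → to (from i) ≡ i
  to-from i = inverseˡ refl

  to-injective : ∀ {x y} → to x ≡ to y → x ≈ y
  to-injective {x} {y} e = trans (sym (from-to x)) (trans (from-cong e) (from-to y))

  _≟_ : ∀ x y → Dec (x ≈ y)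
  x ≟ y = map′ to-injective to-cong (to x FinP.≟ to y)

  onFin : (Carrier → Carrier) → Fin q → Fin q
  onFin h i = to (h (from i))

  Congruent : (Carrier → Carrier) → Set (c ⊔ ℓ)
  Congruent h = ∀ {x y} → x ≈ y → h x ≈ h y

  Injective : (Carrier → Carrier) → Set (c ⊔ ℓ)
  Injective h = ∀ {x y} → h x ≈ h y → x ≈ y

  injective⇒hits : ∀ h → Congruent h → Injective h → ∀ y → ∃ λ z → h z ≈ y
  injective⇒hits h h-cong h-inj y =
    from i , trans (sym (from-to _)) (trans (from-cong hit) (from-to y))
    where
    onFin-inj : ∀ {i j} → onFin h i ≡ onFin h j → i ≡ j
    onFin-inj {i} {j} e =
      P.trans (P.sym (to-from i)) (P.trans (to-cong (h-inj (to-injective e))) (to-from j))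
    i = proj₁ (injective⇒surjective (onFin h) onFin-inj (to y))
    hit = proj₂ (injective⇒surjective (onFin h) onFin-inj (to y))

  -- ... and a map identifying two distinct points misses some value.
  -- If h were surjective, a section of h would be injective, hence
  -- surjective, and then h could not identify x and y.
  nonInjective⇒misses : ∀ h → Congruent h → ∀ x y → ¬ (x ≈ y) → h x ≈ h y →
                        ∃ λ v → ∀ z → ¬ (h z ≈ v)
  nonInjective⇒misses h h-cong x y x≉y hx≈hy
    with FinP.all? (λ j → FinP.any? (λ i → h (from i) ≟ from j))
  ... | no ¬surj =
    let (j , nj) = FinP.¬∀⟶∃¬ q _ (λ j → FinP.any? (λ i → h (from i) ≟ from j)) ¬surj
    in from j , λ z e → nj (to z , trans (h-cong (from-to z)) e)
  ... | yes surj = ⊥-elim (x≉y (to-injective (P.trans (P.sym (proj₂ sx))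
                                   (P.trans (P.cong section same) (proj₂ sy)))))
    where
    section : Fin q → Fin q
    section j = proj₁ (surj j)
    section-spec : ∀ j → h (from (section j)) ≈ from j
    section-spec j = proj₂ (surj j)
    section-inj : ∀ {i j} → section i ≡ section j → i ≡ j
    section-inj {i} {j} e = P.trans (P.sym (to-from i)) (P.trans (to-cong from-i≈from-j) (to-from j))
      where
      from-i≈from-j : from i ≈ from j
      from-i≈from-j = trans (sym (section-spec i)) (trans (h-cong (from-cong e)) (section-spec j))
    sx = injective⇒surjective section section-inj (to x)
    sy = injective⇒surjective section section-inj (to y)
    h-at : ∀ {z k} → section k ≡ to z → h z ≈ from k
    h-at {z} {k} e = trans (h-cong (trans (sym (from-to z)) (from-cong (P.sym e)))) (section-spec k)
    same : proj₁ sx ≡ proj₁ sy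
    same = P.trans (P.sym (to-from _))
             (P.trans (to-cong (trans (sym (h-at (proj₂ sx))) (trans hx≈hy (h-at (proj₂ sy))))) (to-from _))

  1≉0 : ¬ (1# ≈ 0#)
  1≉0 e = 0≉1 (sym e)

  zero-product : ∀ {x y} → x * y ≈ 0# → ¬ (x ≈ 0#) → y ≈ 0#
  zero-product {x} {y} e x≉0 with inverse x x≉0
  ... | (i , xi≈1) = begin
    y            ≈⟨ *-identityˡ y ⟨
    1# * y       ≈⟨ *-congʳ xi≈1 ⟨
    (x * i) * y  ≈⟨ solve 3 (λ x i y → (x :* i) :* y := i :* (x :* y)) refl x i y ⟩
    i * (x * y)  ≈⟨ *-congˡ e ⟩
    i * 0#       ≈⟨ zeroʳ i ⟩
    0#           ∎

  *-nonzero : ∀ {x y} → ¬ (x ≈ 0#) → ¬ (y ≈ 0#) → ¬ (x * y ≈ 0#)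
  *-nonzero x≉0 y≉0 e = y≉0 (zero-product e x≉0)

  -‿nonzero : ∀ {x} → ¬ (x ≈ 0#) → ¬ (- x ≈ 0#)
  -‿nonzero x≉0 e = x≉0 (⁻¹-injective (trans e (sym ε⁻¹≈ε)))

  *-cancelˡ : ∀ {k a b} → ¬ (k ≈ 0#) → k * a ≈ k * b → a ≈ b
  *-cancelˡ {k} {a} {b} k≉0 e = x∙y⁻¹≈ε⇒x≈y a b (zero-product k[a-b]≈0 k≉0)
    where
    k[a-b]≈0 : k * (a - b) ≈ 0#
    k[a-b]≈0 = trans (solve 3 (λ k a b → k :* (a :- b) := k :* a :- k :* b) refl k a b)
                     (x≈y⇒x∙y⁻¹≈ε e)

  square-roots : ∀ {x y} → x * x ≈ y * y → (x ≈ y) ⊎ (x ≈ - y)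
  square-roots {x} {y} e with (x - y) ≟ 0#
  ... | yes x-y≈0 = inj₁ (x∙y⁻¹≈ε⇒x≈y x y x-y≈0)
  ... | no x-y≉0 = inj₂ (x∙y⁻¹≈ε⇒x≈y x (- y) (zero-product factored x-y≉0))
    where
    factored : (x - y) * (x - - y) ≈ 0#
    factored = trans (solve 2 (λ x y → (x :- y) :* (x :- (:- y)) := x :* x :- y :* y) refl x y)
                     (x≈y⇒x∙y⁻¹≈ε e)

  self-negative : ¬ (N 2 ≈ 0#) → ∀ {x} → x ≈ - x → x ≈ 0#
  self-negative 2≉0 {x} e = zero-product 2x≈0 2≉0
    where
    2x≈0 : N 2 * x ≈ 0#
    2x≈0 = trans (solve 1 (λ x → con (+ 2) :* x := x :+ x) refl x)
                 (trans (+-congˡ e) (-‿inverseʳ x))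

  -- total reciprocal (1/0 := 0)
  recip : Carrier → Carrier
  recip x with x ≟ 0#
  ... | yes _ = 0#
  ... | no x≉0 = proj₁ (inverse x x≉0)

  recip-inverse : ∀ {x} → ¬ (x ≈ 0#) → x * recip x ≈ 1#
  recip-inverse {x} x≉0 with x ≟ 0#
  ... | yes x≈0 = ⊥-elim (x≉0 x≈0)
  ... | no x≉0′ = proj₂ (inverse x x≉0′)

  recip-nonzero : ∀ {x} → ¬ (x ≈ 0#) → ¬ (recip x ≈ 0#)
  recip-nonzero {x} x≉0 e = 0≉1 (trans (sym (zeroʳ x)) (trans (*-congˡ (sym e)) (recip-inverse x≉0)))

  recip-cong : Congruent recip
  recip-cong {x} {y} x≈y with x ≟ 0# | y ≟ 0#
  ... | yes _ | yes _ = refl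
  ... | yes x≈0 | no y≉0 = ⊥-elim (y≉0 (trans (sym x≈y) x≈0))
  ... | no x≉0 | yes y≈0 = ⊥-elim (x≉0 (trans x≈y y≈0))
  ... | no x≉0 | no y≉0 = *-cancelˡ x≉0 (trans (proj₂ (inverse x x≉0))
                                          (sym (trans (*-congʳ x≈y) (proj₂ (inverse y y≉0)))))

  divide-out : ∀ {u y g} → ¬ (y ≈ 0#) → u * y + g ≈ 0# → u + g * recip y ≈ 0#
  divide-out {u} {y} {g} y≉0 e = begin
    u + g * r                ≈⟨ +-congʳ (trans (*-congˡ (recip-inverse y≉0)) (*-identityʳ u)) ⟨
    u * (y * r) + g * r      ≈⟨ solve 4 (λ u y g r → u :* (y :* r) :+ g :* r := (u :* y :+ g) :* r) refl u y g r ⟩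
    (u * y + g) * r          ≈⟨ *-congʳ e ⟩
    0# * r                   ≈⟨ zeroˡ r ⟩
    0#                       ∎
    where r = recip y

  -- Every map misses some value on the nonzero elements: compose it with
  -- the map sending 0 to 1 and fixing everything else, which identifies 0 and 1.
  nonzero-image-misses : ∀ k → Congruent k → ∃ λ v → ∀ x → ¬ (x ≈ 0#) → ¬ (k x ≈ v)
  nonzero-image-misses k k-cong =
    let (v , missed) = nonInjective⇒misses (λ x → k (nonzeroRep x)) (λ e → k-cong (rep-cong e)) 0# 1# 0≉1
                          (k-cong (trans rep-0 (sym (rep-nonzero 1≉0))))
    in v , λ x x≉0 e → missed x (trans (k-cong (rep-nonzero x≉0)) e)
    where
    nonzeroRep : Carrier → Carrier
    nonzeroRep x with x ≟ 0#
    ... | yes _ = 1#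
    ... | no _ = x
    rep-cong : Congruent nonzeroRep
    rep-cong {x} {y} e with x ≟ 0# | y ≟ 0#
    ... | yes _ | yes _ = refl
    ... | no _ | no _ = e
    ... | yes x≈0 | no y≉0 = ⊥-elim (y≉0 (trans (sym e) x≈0))
    ... | no x≉0 | yes y≈0 = ⊥-elim (x≉0 (trans e y≈0))
    rep-0 : nonzeroRep 0# ≈ 1#
    rep-0 with 0# ≟ 0#
    ... | yes _ = refl
    ... | no 0≉0 = ⊥-elim (0≉0 refl)
    rep-nonzero : ∀ {x} → ¬ (x ≈ 0#) → nonzeroRep x ≈ x
    rep-nonzero {x} x≉0 with x ≟ 0#
    ... | yes x≈0 = ⊥-elim (x≉0 x≈0)
    ... | no _ = refl

  linear-root : ∀ B {C} → ¬ (C ≈ 0#) → B + (- (B * recip C)) * C ≈ 0#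
  linear-root B {C} C≉0 = begin
    B + (- (B * r)) * C  ≈⟨ solve 3 (λ B r C → B :+ (:- (B :* r)) :* C := B :- B :* (C :* r)) refl B r C ⟩
    B - B * (C * r)      ≈⟨ +-congˡ (-‿cong (trans (*-congˡ (recip-inverse C≉0)) (*-identityʳ B))) ⟩
    B - B                ≈⟨ -‿inverseʳ B ⟩
    0#                   ∎
    where r = recip C

  char3⇒2≉0 : N 3 ≈ 0# → ¬ (N 2 ≈ 0#)
  char3⇒2≉0 3≈0 2≈0 = 1≉0 (begin
    1#            ≈⟨ +-identityˡ 1# ⟨
    0# + 1#       ≈⟨ +-congʳ 2≈0 ⟨
    N 2 + 1#      ≈⟨ 3≈0 ⟩
    0#            ∎)

  natMul≈N : ∀ n → natMul field' n ≈ N n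
  natMul≈N zero = refl
  natMul≈N (suc n) = trans (+-congˡ (natMul≈N n)) (sym (N-suc n))

  char3⇒3≈0 : HasCharacteristic field' 3 → N 3 ≈ 0#
  char3⇒3≈0 (_ , 3≈0 , _) = trans (sym (natMul≈N 3)) 3≈0

  3≈0⇒char3 : N 3 ≈ 0# → HasCharacteristic field' 3
  3≈0⇒char3 3≈0 = s≤s z≤n , trans (natMul≈N 3) 3≈0 , smaller
    where
    smaller : ∀ m → 0 ℕ.< m → m ℕ.< 3 → ¬ (natMul field' m ≈ 0#)
    smaller 1 _ _ e = 1≉0 (trans (sym (natMul≈N 1)) e)
    smaller 2 _ _ e = char3⇒2≉0 3≈0 (trans (sym (natMul≈N 2)) e)
    smaller (suc (suc (suc _))) _ (s≤s (s≤s (s≤s ())))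

  -- in characteristic ≠ 2 some element is not a square: z ↦ z² identifies 1 and -1
  nonsquare : ¬ (N 2 ≈ 0#) → ∃ λ n → ∀ z → ¬ (z * z ≈ n)
  nonsquare 2≉0 = nonInjective⇒misses (λ z → z * z) (λ e → *-cong e e) 1# (- 1#) 1≉-1
                    (solve 1 (λ u → u :* u := (:- u) :* (:- u)) refl 1#)
    where
    1≉-1 : ¬ (1# ≈ - 1#)
    1≉-1 e = 1≉0 (self-negative 2≉0 e)

  quarter : (2≉0 : ¬ (N 2 ≈ 0#)) → ∀ M → recip (N 2) * recip (N 2) * (N 4 * M) ≈ M
  quarter 2≉0 M = begin
    h * h * (N 4 * M)              ≈⟨ solve 2 (λ h M → h :* h :* (con (+ 4) :* M)
                                          := (con (+ 2) :* h) :* (con (+ 2) :* h) :* M) refl h M ⟩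
    (N 2 * h) * (N 2 * h) * M      ≈⟨ *-congʳ (*-cong (recip-inverse 2≉0) (recip-inverse 2≉0)) ⟩
    1# * 1# * M                    ≈⟨ trans (*-congʳ (*-identityˡ 1#)) (*-identityˡ M) ⟩
    M                              ∎
    where h = recip (N 2)

  -- A choice of one element from each pair {x, -x}: x is "positive" if
  -- its index in the enumeration is at most that of -x.
  Positive : Carrier → Set
  Positive x = toℕ (to x) ℕ.≤ toℕ (to (- x))

  positive? : ∀ x → Dec (Positive x)
  positive? x = toℕ (to x) ℕ.≤? toℕ (to (- x))

  positive-cong : ∀ {x y} → x ≈ y → Positive x → Positive y
  positive-cong e = P.subst₂ (λ a b → toℕ a ℕ.≤ toℕ b) (to-cong e) (to-cong (-‿cong e))

  positive-0 : Positive 0#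
  positive-0 = P.subst (λ b → toℕ (to 0#) ℕ.≤ toℕ b) (to-cong (sym ε⁻¹≈ε)) ℕP.≤-refl

  swapped-indices : ∀ {x y} → x ≈ - y → toℕ (to x) ≡ toℕ (to (- y)) × toℕ (to (- x)) ≡ toℕ (to y)
  swapped-indices {x} {y} e = P.cong toℕ (to-cong e) , P.cong toℕ (to-cong (trans (-‿cong e) (⁻¹-involutive y)))

  both-signs-positive : ¬ (N 2 ≈ 0#) → ∀ {x y} → x ≈ - y → Positive x → Positive y → y ≈ 0#
  both-signs-positive 2≉0 {x} {y} e px py = self-negative 2≉0 (to-injective (FinP.toℕ-injective same))
    where
    same : toℕ (to y) ≡ toℕ (to (- y))
    same with swapped-indices e
    ... | x≡-y , -x≡y = ℕP.≤-antisym py (P.subst₂ ℕ._≤_ x≡-y -x≡y px)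

  some-sign-positive : ∀ {x y} → x ≈ - y → ¬ Positive x → ¬ Positive y → ⊥
  some-sign-positive {x} {y} e npx npy with swapped-indices e
  ... | x≡-y , -x≡y = ℕP.<-asym (ℕP.≰⇒> npy) (P.subst₂ ℕ._<_ -x≡y x≡-y (ℕP.≰⇒> npx))

  -- If M is not of the form a² + 3b² (characteristic ≠ 2, 3), the map ψ
  -- sending positive x to x² and the others to M - 3x² is injective but
  -- misses M, contradicting the pigeonhole principle.
  module Unrepresented (2≉0 : ¬ (N 2 ≈ 0#)) (3≉0 : ¬ (N 3 ≈ 0#)) (M : Carrier)
                       (unrepresented : ∀ a b → ¬ (a * a + N 3 * (b * b) ≈ M)) where
    ψ : Carrier → Carrier
    ψ x with positive? x
    ... | yes _ = x * x
    ... | no _ = M - N 3 * (x * x)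

    ψ-cong : Congruent ψ
    ψ-cong {x} {y} e with positive? x | positive? y
    ... | yes _ | yes _ = *-cong e e
    ... | no _ | no _ = +-congˡ (-‿cong (*-congˡ (*-cong e e)))
    ... | yes px | no npy = ⊥-elim (npy (positive-cong e px))
    ... | no npx | yes py = ⊥-elim (npx (positive-cong (sym e) py))

    branches-disjoint : ∀ x y → ¬ (x * x ≈ M - N 3 * (y * y))
    branches-disjoint x y e = unrepresented x y (begin
      x * x + N 3 * (y * y)                ≈⟨ +-congʳ e ⟩
      (M - N 3 * (y * y)) + N 3 * (y * y)  ≈⟨ solve 2 (λ m z → (m :- z) :+ z := m) refl M (N 3 * (y * y)) ⟩
      M                                    ∎)

    -- within a branch, equal values come from x ≈ ±y, and -y is positive
    -- exactly when y is not (for y ≉ 0)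
    ψ-injective : Injective ψ
    ψ-injective {x} {y} e with positive? x | positive? y
    ... | yes _ | no _ = ⊥-elim (branches-disjoint x y e)
    ... | no _ | yes _ = ⊥-elim (branches-disjoint y x (sym e))
    ... | yes px | yes py with square-roots e
    ...   | inj₁ x≈y = x≈y
    ...   | inj₂ x≈-y = trans x≈-y (trans (-‿cong y≈0) (trans ε⁻¹≈ε (sym y≈0)))
      where y≈0 = both-signs-positive 2≉0 x≈-y px py
    ψ-injective {x} {y} e | no npx | no npy with square-roots x²≈y²
      where
      x²≈y² : x * x ≈ y * y
      x²≈y² = *-cancelˡ 3≉0 (x∙y⁻¹≈ε⇒x≈y _ _ (trans
        (solve 3 (λ m a b → a :- b := (m :- b) :- (m :- a)) refl M (N 3 * (x * x)) (N 3 * (y * y)))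
        (x≈y⇒x∙y⁻¹≈ε (sym e))))
    ... | inj₁ x≈y = x≈y
    ... | inj₂ x≈-y = ⊥-elim (some-sign-positive x≈-y npx npy)

    -- M = z² + 3·0², and M = M - 3z² forces z ≈ 0, which is positive
    ψ-misses-M : ∀ z → ¬ (ψ z ≈ M)
    ψ-misses-M z ψz≈M with positive? z
    ... | yes _ = unrepresented z 0# (trans (+-congˡ (trans (*-congˡ (zeroˡ 0#)) (zeroʳ _)))
                                           (trans (+-identityʳ _) ψz≈M))
    ... | no npz = npz (positive-cong (sym z≈0) positive-0)
      where
      3z²≈0 : N 3 * (z * z) ≈ 0#
      3z²≈0 = trans (sym (solve 2 (λ m t → m :- (m :- t) := t) refl M (N 3 * (z * z))))
                    (x≈y⇒x∙y⁻¹≈ε (sym ψz≈M))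
      z≈0 : z ≈ 0#
      z≈0 with z ≟ 0#
      ... | yes p = p
      ... | no z≉0 = ⊥-elim (*-nonzero 3≉0 (*-nonzero z≉0 z≉0) 3z²≈0)

  square-plus-thrice-square : ¬ (N 2 ≈ 0#) → ¬ (N 3 ≈ 0#) → ∀ M →
                              ∃ λ a → ∃ λ b → a * a + N 3 * (b * b) ≈ M
  square-plus-thrice-square 2≉0 3≉0 M
    with FinP.any? (λ i → FinP.any? (λ j → (from i * from i + N 3 * (from j * from j)) ≟ M))
  ... | yes (i , j , e) = from i , from j , e
  ... | no none = ⊥-elim (ψ-misses-M (proj₁ hit) (proj₂ hit))
    where
    unrepresented : ∀ a b → ¬ (a * a + N 3 * (b * b) ≈ M)
    unrepresented a b e =
      none (to a , to b , trans (+-cong (*-cong (from-to a) (from-to a))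
                                        (*-congˡ (*-cong (from-to b) (from-to b)))) e)
    open Unrepresented 2≉0 3≉0 M unrepresented
    hit = injective⇒hits ψ ψ-cong ψ-injective M

-- A polynomial whose constant term is still free has no root for some
-- nonzero choice of that term iff its non-constant part identifies two
-- points; deciding when these maps are injective is the algebraic core
-- of the degree 2 and 3 cases.

module LowDegreeMaps {c ℓ : Level} {q : ℕ} (F : FiniteField c ℓ q) where
  open FieldFacts F
  open import Relation.Binary.Reasoning.Setoid setoid

  quadratic : Carrier → Carrier → Carrier → Carrier
  quadratic B C u = u * (B + u * C)

  cubic : Carrier → Carrier → Carrier → Carrier → Carrier
  cubic B A C u = u * (B + u * (A + u * C))

  quadratic-cong : ∀ B C → Congruent (quadratic B C)
  quadratic-cong B C e = *-cong e (+-congˡ (*-congʳ e))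

  cubic-cong : ∀ B A C → Congruent (cubic B A C)
  cubic-cong B A C e = *-cong e (+-congˡ (*-cong e (+-congˡ (*-congʳ e))))

  cubic-0 : ∀ B A C → cubic B A C 0# ≈ 0#
  cubic-0 B A C = zeroˡ _

  Collision : (Carrier → Carrier) → Set (c ⊔ ℓ)
  Collision h = ∃ λ x → ∃ λ y → ¬ (x ≈ y) × h x ≈ h y

  collision⇒avoidable : ∀ h → Congruent h → h 0# ≈ 0# → Collision h →
                        ∃ λ v → ¬ (v ≈ 0#) × (∀ z → ¬ (v + h z ≈ 0#))
  collision⇒avoidable h h-cong h0 (x , y , x≉y , hx≈hy) = v , v≉0 , avoids
    where
    missed = nonInjective⇒misses (λ z → - h z) (λ e → -‿cong (h-cong e)) x y x≉y (-‿cong hx≈hy)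
    v = proj₁ missed
    avoids : ∀ z → ¬ (v + h z ≈ 0#)
    avoids z e = proj₂ missed z (sym (begin
      v                  ≈⟨ +-identityʳ v ⟨
      v + 0#             ≈⟨ +-congˡ (-‿inverseʳ (h z)) ⟨
      v + (h z - h z)    ≈⟨ +-assoc _ _ _ ⟨
      (v + h z) - h z    ≈⟨ +-congʳ e ⟩
      0# + - h z         ≈⟨ +-identityˡ _ ⟩
      - h z              ∎))
    v≉0 : ¬ (v ≈ 0#)
    v≉0 e = avoids 0# (trans (+-cong e h0) (+-identityˡ 0#))

  injective⇒solvable : ∀ h → Congruent h → Injective h → ∀ v → ∃ λ z → v + h z ≈ 0#
  injective⇒solvable h h-cong h-inj v =
    let (z , hz≈-v) = injective⇒hits h h-cong h-inj (- v) in z , trans (+-congˡ hz≈-v) (-‿inverseʳ v)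

  ratio : Carrier → Carrier → Carrier
  ratio X C = - (X * recip C)

  ratio-nonzero : ∀ {X C} → ¬ (X ≈ 0#) → ¬ (C ≈ 0#) → ¬ (ratio X C ≈ 0#)
  ratio-nonzero X≉0 C≉0 = -‿nonzero (*-nonzero X≉0 (recip-nonzero C≉0))

  two-zeros⇒collision : ∀ h y → ¬ (y ≈ 0#) → h 0# ≈ 0# → h y ≈ 0# → Collision h
  two-zeros⇒collision h y y≉0 h0 hy = 0# , y , (λ e → y≉0 (sym e)) , trans h0 (sym hy)

  -- B u + C u² vanishes at 0 and -B/C
  quadratic-collision : ∀ B C → ¬ (B ≈ 0#) → ¬ (C ≈ 0#) → Collision (quadratic B C)
  quadratic-collision B C B≉0 C≉0 =
    two-zeros⇒collision (quadratic B C) (ratio B C) (ratio-nonzero B≉0 C≉0) (zeroˡ _)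
      (trans (*-congˡ (linear-root B C≉0)) (zeroʳ _))

  -- A u² + C u³ vanishes at 0 and -A/C
  cubic-collision-B≈0 : ∀ B A C → B ≈ 0# → ¬ (A ≈ 0#) → ¬ (C ≈ 0#) → Collision (cubic B A C)
  cubic-collision-B≈0 B A C B≈0 A≉0 C≉0 =
    two-zeros⇒collision (cubic B A C) y (ratio-nonzero A≉0 C≉0) (cubic-0 B A C) (begin
      y * (B + y * (A + y * C))  ≈⟨ *-congˡ (+-cong B≈0 (*-congˡ (linear-root A C≉0))) ⟩
      y * (0# + y * 0#)          ≈⟨ solve 1 (λ y → y :* (con (+ 0) :+ y :* con (+ 0)) := con (+ 0)) refl y ⟩
      0#                         ∎)
    where y = ratio A C

  cubic-difference : ∀ B A C x y →
    cubic B A C x - cubic B A C y ≈ (x - y) * (B + A * (x + y) + C * (x * x + x * y + y * y))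
  cubic-difference = solve 5 (λ B A C x y →
    (x :* (B :+ x :* (A :+ x :* C))) :- (y :* (B :+ y :* (A :+ y :* C)))
      := (x :- y) :* (B :+ A :* (x :+ y) :+ C :* (x :* x :+ x :* y :+ y :* y))) refl

  cubic-collision-from-norm : ∀ B A C → A ≈ 0# → ¬ (C ≈ 0#) → ∀ x y → ¬ (x ≈ y) →
    x * x + x * y + y * y ≈ ratio B C → Collision (cubic B A C)
  cubic-collision-from-norm B A C A≈0 C≉0 x y x≉y norm =
    x , y , x≉y , x∙y⁻¹≈ε⇒x≈y _ _ (trans (cubic-difference B A C x y) (trans (*-congˡ factor≈0) (zeroʳ _)))
    where
    factor≈0 : B + A * (x + y) + C * (x * x + x * y + y * y) ≈ 0#
    factor≈0 = begin
      B + A * (x + y) + C * (x * x + x * y + y * y)  ≈⟨ +-cong (+-congˡ (trans (*-congʳ A≈0) (zeroˡ _))) (*-congˡ norm) ⟩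
      B + 0# + C * ratio B C                         ≈⟨ +-congʳ (+-identityʳ B) ⟩
      B + C * ratio B C                              ≈⟨ +-congˡ (*-comm _ _) ⟩
      B + ratio B C * C                              ≈⟨ linear-root B C≉0 ⟩
      0#                                             ∎

  square-injective-char2 : N 2 ≈ 0# → Injective (λ z → z * z)
  square-injective-char2 2≈0 {x} {y} e with (x - y) ≟ 0#
  ... | yes x-y≈0 = x∙y⁻¹≈ε⇒x≈y x y x-y≈0
  ... | no x-y≉0 = ⊥-elim (x-y≉0 (zero-product [x-y]²≈0 x-y≉0))
    where
    [x-y]²≈0 : (x - y) * (x - y) ≈ 0#
    [x-y]²≈0 = begin
      (x - y) * (x - y)                        ≈⟨ solve 2 (λ x y → (x :- y) :* (x :- y)
                                                     := (x :* x :- y :* y) :+ con (+ 2) :* (y :* y :- x :* y)) refl x y ⟩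
      (x * x - y * y) + N 2 * (y * y - x * y)  ≈⟨ +-cong (x≈y⇒x∙y⁻¹≈ε e) (trans (*-congʳ 2≈0) (zeroˡ _)) ⟩
      0# + 0#                                  ≈⟨ +-identityʳ _ ⟩
      0#                                       ∎

  OffDiagonalPoint : Carrier → Set (c ⊔ ℓ)
  OffDiagonalPoint M = ∃ λ x → ∃ λ y → ¬ (x ≈ y) × x * x + x * y + y * y ≈ M

  -- in characteristic 2 take (√M, 0)
  off-diagonal-char2 : N 2 ≈ 0# → ∀ {M} → ¬ (M ≈ 0#) → OffDiagonalPoint M
  off-diagonal-char2 2≈0 {M} M≉0 = r , 0# , r≉0 , norm
    where
    root = injective⇒hits (λ z → z * z) (λ e → *-cong e e) (square-injective-char2 2≈0) M
    r = proj₁ root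
    r≉0 : ¬ (r ≈ 0#)
    r≉0 e = M≉0 (trans (sym (proj₂ root)) (trans (*-cong e e) (zeroˡ 0#)))
    norm : r * r + r * 0# + 0# * 0# ≈ M
    norm = trans (solve 1 (λ r → r :* r :+ r :* con (+ 0) :+ con (+ 0) :* con (+ 0) := r :* r) refl r)
                 (proj₂ root)

  -- otherwise write 4M = a² + 3b² and take ((b + a)/2, (b - a)/2), or
  -- (b, -b/2) if a ≈ 0
  off-diagonal : ¬ (N 2 ≈ 0#) → ¬ (N 3 ≈ 0#) → ∀ {M} → ¬ (M ≈ 0#) → OffDiagonalPoint M
  off-diagonal 2≉0 3≉0 {M} M≉0 with square-plus-thrice-square 2≉0 3≉0 (N 4 * M)
  ... | a , b , rep with a ≟ 0#
  ...   | no a≉0 = x , y , x≉y , norm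
    where
    h = recip (N 2)
    2h≈1 : N 2 * h ≈ 1#
    2h≈1 = recip-inverse 2≉0
    x = (b + a) * h
    y = (b - a) * h
    x≉y : ¬ (x ≈ y)
    x≉y e = a≉0 (trans (sym (trans (*-congˡ 2h≈1) (*-identityʳ a)))
                 (trans (solve 3 (λ a b h → a :* (con (+ 2) :* h) := (b :+ a) :* h :- (b :- a) :* h) refl a b h)
                        (x≈y⇒x∙y⁻¹≈ε e)))
    norm : x * x + x * y + y * y ≈ M
    norm = begin
      x * x + x * y + y * y             ≈⟨ solve 3 (λ a b h →
                                             ((b :+ a) :* h) :* ((b :+ a) :* h) :+ ((b :+ a) :* h) :* ((b :- a) :* h)
                                               :+ ((b :- a) :* h) :* ((b :- a) :* h)
                                             := h :* h :* (a :* a :+ con (+ 3) :* (b :* b))) refl a b h ⟩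
      h * h * (a * a + N 3 * (b * b))   ≈⟨ *-congˡ rep ⟩
      h * h * (N 4 * M)                 ≈⟨ quarter 2≉0 M ⟩
      M                                 ∎
  ...   | yes a≈0 = x , y , x≉y , norm
    where
    h = recip (N 2)
    r = b * h
    x = N 2 * r
    y = - r
    3b²≈4M : N 3 * (b * b) ≈ N 4 * M
    3b²≈4M = trans (sym (trans (+-congʳ (trans (*-congˡ a≈0) (zeroʳ a))) (+-identityˡ _))) rep
    norm′ : h * h * (N 3 * (b * b)) ≈ M
    norm′ = trans (*-congˡ 3b²≈4M) (quarter 2≉0 M)
    r≉0 : ¬ (r ≈ 0#)
    r≉0 e = M≉0 (begin
      M                            ≈⟨ norm′ ⟨
      h * h * (N 3 * (b * b))      ≈⟨ solve 2 (λ h b → h :* h :* (con (+ 3) :* (b :* b))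
                                         := con (+ 3) :* ((b :* h) :* (b :* h))) refl h b ⟩
      N 3 * (r * r)                ≈⟨ *-congˡ (trans (*-congˡ e) (zeroʳ r)) ⟩
      N 3 * 0#                     ≈⟨ zeroʳ _ ⟩
      0#                           ∎)
    x≉y : ¬ (x ≈ y)
    x≉y e = *-nonzero 3≉0 r≉0 (trans (solve 1 (λ r → con (+ 3) :* r := con (+ 2) :* r :- (:- r)) refl r)
                                    (x≈y⇒x∙y⁻¹≈ε e))
    norm : x * x + x * y + y * y ≈ M
    norm = trans (solve 2 (λ b h → (con (+ 2) :* (b :* h)) :* (con (+ 2) :* (b :* h))
                                     :+ (con (+ 2) :* (b :* h)) :* (:- (b :* h)) :+ (:- (b :* h)) :* (:- (b :* h))
                                   := h :* h :* (con (+ 3) :* (b :* b))) refl b h)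
                 norm′

  cubic-collision-A≈0 : ∀ B A C → A ≈ 0# → ¬ (B ≈ 0#) → ¬ (C ≈ 0#) → ¬ (N 3 ≈ 0#) →
                        Collision (cubic B A C)
  cubic-collision-A≈0 B A C A≈0 B≉0 C≉0 3≉0 = from-point point
    where
    point : OffDiagonalPoint (ratio B C)
    point with N 2 ≟ 0#
    ... | yes 2≈0 = off-diagonal-char2 2≈0 (ratio-nonzero B≉0 C≉0)
    ... | no 2≉0 = off-diagonal 2≉0 3≉0 (ratio-nonzero B≉0 C≉0)
    from-point : OffDiagonalPoint (ratio B C) → Collision (cubic B A C)
    from-point (x , y , x≉y , norm) = cubic-collision-from-norm B A C A≈0 C≉0 x y x≉y norm

  OneZero : Carrier → Carrier → Set ℓ
  OneZero x y = (x ≈ 0# × ¬ (y ≈ 0#)) ⊎ (¬ (x ≈ 0#) × y ≈ 0#)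

  OneZero-sym : ∀ {x y} → OneZero x y → OneZero y x
  OneZero-sym (inj₁ (x≈0 , y≉0)) = inj₂ (y≉0 , x≈0)
  OneZero-sym (inj₂ (x≉0 , y≈0)) = inj₁ (y≈0 , x≉0)

  -- Nora's reply in the middle: 1 against 0, and 0 against anything else
  complement : ∀ x → ∃ λ y → OneZero x y
  complement x with x ≟ 0#
  ... | yes x≈0 = 1# , inj₁ (x≈0 , 1≉0)
  ... | no x≉0 = 0# , inj₂ (x≉0 , refl)

  cubic-collision : ¬ (N 3 ≈ 0#) → ∀ {B A C} → OneZero B A → ¬ (C ≈ 0#) → Collision (cubic B A C)
  cubic-collision 3≉0 {B} {A} {C} (inj₁ (B≈0 , A≉0)) C≉0 = cubic-collision-B≈0 B A C B≈0 A≉0 C≉0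
  cubic-collision 3≉0 {B} {A} {C} (inj₂ (B≉0 , A≈0)) C≉0 = cubic-collision-A≈0 B A C A≈0 B≉0 C≉0 3≉0

  -- In characteristic 3, x² + xy + y² = (x - y)², so B u + C u³ is injective
  -- as soon as -B/C is not a nonzero square.
  cubic-injective-char3 : N 3 ≈ 0# → ∀ B A C → A ≈ 0# →
    (∀ δ → ¬ (δ ≈ 0#) → ¬ (C * (δ * δ) + B ≈ 0#)) → Injective (cubic B A C)
  cubic-injective-char3 3≈0 B A C A≈0 no-root {x} {y} e with (x - y) ≟ 0#
  ... | yes x-y≈0 = x∙y⁻¹≈ε⇒x≈y x y x-y≈0
  ... | no x-y≉0 = ⊥-elim (no-root (x - y) x-y≉0 (begin
    C * ((x - y) * (x - y)) + B                                ≈⟨ +-identityʳ _ ⟨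
    (C * ((x - y) * (x - y)) + B) + 0#                         ≈⟨ +-congˡ vanishing ⟨
    (C * ((x - y) * (x - y)) + B) + (A * (x + y) + C * (N 3 * (x * y)))
                                                              ≈⟨ solve 5 (λ B A C x y →
                                                                   (C :* ((x :- y) :* (x :- y)) :+ B) :+ (A :* (x :+ y) :+ C :* (con (+ 3) :* (x :* y)))
                                                                   := B :+ A :* (x :+ y) :+ C :* (x :* x :+ x :* y :+ y :* y)) refl B A C x y ⟩
    B + A * (x + y) + C * (x * x + x * y + y * y)             ≈⟨ zero-product (trans (sym (cubic-difference B A C x y)) (x≈y⇒x∙y⁻¹≈ε e)) x-y≉0 ⟩
    0#                                                        ∎))
    where
    vanishing : A * (x + y) + C * (N 3 * (x * y)) ≈ 0#
    vanishing = trans (+-cong (trans (*-congʳ A≈0) (zeroˡ _)) (trans (*-congˡ (trans (*-congʳ 3≈0) (zeroˡ _))) (zeroʳ C)))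
                      (+-identityʳ 0#)

  cube-injective-char3 : N 3 ≈ 0# → ∀ {C} → ¬ (C ≈ 0#) → Injective (cubic 0# 0# C)
  cube-injective-char3 3≈0 {C} C≉0 = cubic-injective-char3 3≈0 0# 0# C refl
    (λ δ δ≉0 e → *-nonzero C≉0 (*-nonzero δ≉0 δ≉0) (trans (sym (+-identityʳ _)) e))

  -- In characteristic ≠ 2, for any w there is C ≉ 0 with C δ² + w ≉ 0 for
  -- all δ ≉ 0: take C = -w/n for a nonsquare n (or C = 1 if w ≈ 0).
  nonsquare-coefficient : ¬ (N 2 ≈ 0#) → ∀ w →
    ∃ λ C → ¬ (C ≈ 0#) × (∀ δ → ¬ (δ ≈ 0#) → ¬ (C * (δ * δ) + w ≈ 0#))
  nonsquare-coefficient 2≉0 w with w ≟ 0#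
  ... | yes w≈0 = 1# , 1≉0 , λ δ δ≉0 e → *-nonzero δ≉0 δ≉0
                    (trans (sym (*-identityˡ _)) (trans (sym (+-identityʳ _)) (trans (+-congˡ (sym w≈0)) e)))
  ... | no w≉0 = C , C≉0 , no-root
    where
    n = proj₁ (nonsquare 2≉0)
    n≉0 : ¬ (n ≈ 0#)
    n≉0 e = proj₂ (nonsquare 2≉0) 0# (trans (zeroˡ 0#) (sym e))
    i = recip n
    C = ratio w n
    C≉0 : ¬ (C ≈ 0#)
    C≉0 = ratio-nonzero w≉0 n≉0
    no-root : ∀ δ → ¬ (δ ≈ 0#) → ¬ (C * (δ * δ) + w ≈ 0#)
    no-root δ δ≉0 e = proj₂ (nonsquare 2≉0) δ
      (sym (x∙y⁻¹≈ε⇒x≈y _ _ (zero-product (zero-product (trans (*-comm _ _) scaled) (recip-nonzero n≉0)) w≉0)))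
      where
      scaled : w * (n - δ * δ) * i ≈ 0#
      scaled = begin
        w * (n - δ * δ) * i        ≈⟨ solve 4 (λ w n δ i → w :* (n :- δ :* δ) :* i
                                         := (:- (w :* i)) :* (δ :* δ) :+ w :* (n :* i)) refl w n δ i ⟩
        C * (δ * δ) + w * (n * i)  ≈⟨ +-congˡ (trans (*-congˡ (recip-inverse n≉0)) (*-identityʳ w)) ⟩
        C * (δ * δ) + w            ≈⟨ e ⟩
        0#                         ∎

module Evaluation {c ℓ : Level} {q : ℕ} (F : FiniteField c ℓ q) where
  open FieldFacts F
  open import Relation.Binary.Reasoning.Setoid setoid

  Σ : (n : ℕ) → (Fin n → Carrier) → Carrier
  Σ = sumFin field'

  Σ-cong : ∀ n {b b′ : Fin n → Carrier} → (∀ j → b j ≈ b′ j) → Σ n b ≈ Σ n b′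
  Σ-cong zero e = refl
  Σ-cong (suc n) e = +-cong (e fzero) (Σ-cong n (λ j → e (fsuc j)))

  Σ-scale : ∀ n x (b : Fin n → Carrier) → x * Σ n b ≈ Σ n (λ j → x * b j)
  Σ-scale zero x b = zeroʳ x
  Σ-scale (suc n) x b = trans (distribˡ x _ _) (+-congˡ (Σ-scale n x (λ j → b (fsuc j))))

  Σ-isolate : ∀ n (b b₀ : Fin n → Carrier) i → b₀ i ≈ 0# → (∀ j → i ≢ j → b j ≈ b₀ j) →
              Σ n b ≈ b i + Σ n b₀
  Σ-isolate (suc n) b b₀ fzero b₀i≈0 agree = +-congˡ (begin
    Σ n (λ j → b (fsuc j))            ≈⟨ Σ-cong n (λ j → agree (fsuc j) (λ ())) ⟩
    Σ n (λ j → b₀ (fsuc j))           ≈⟨ +-identityˡ _ ⟨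
    0# + Σ n (λ j → b₀ (fsuc j))      ≈⟨ +-congʳ b₀i≈0 ⟨
    Σ (suc n) b₀                      ∎)
  Σ-isolate (suc n) b b₀ (fsuc i) b₀i≈0 agree = begin
    b fzero + Σ n (λ j → b (fsuc j))              ≈⟨ +-cong (agree fzero (λ ()))
                                                      (Σ-isolate n (λ j → b (fsuc j)) (λ j → b₀ (fsuc j)) i b₀i≈0
                                                        (λ j i≢j → agree (fsuc j) (λ e → i≢j (FinP.suc-injective e)))) ⟩
    b₀ fzero + (b (fsuc i) + Σ n (λ j → b₀ (fsuc j))) ≈⟨ solve 3 (λ x y z → x :+ (y :+ z) := y :+ (x :+ z)) refl _ _ _ ⟩
    b (fsuc i) + Σ (suc n) b₀                      ∎

  xⁿ : Carrier → ℕ → Carrier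
  xⁿ = pow field'

  pow-cong : ∀ n {x y} → x ≈ y → xⁿ x n ≈ xⁿ y n
  pow-cong zero e = refl
  pow-cong (suc n) e = *-cong e (pow-cong n e)

  pow-nonzero : ∀ n {x} → ¬ (x ≈ 0#) → ¬ (xⁿ x n ≈ 0#)
  pow-nonzero zero x≉0 = 1≉0
  pow-nonzero (suc n) x≉0 = *-nonzero x≉0 (pow-nonzero n x≉0)

  pow-1 : ∀ n → xⁿ 1# n ≈ 1#
  pow-1 zero = refl
  pow-1 (suc n) = trans (*-identityˡ _) (pow-1 n)

  module _ (d : ℕ) where
    ev : (Fin (suc d) → Carrier) → Carrier → Carrier
    ev = evalPoly field' d

    ev-cong : ∀ a {x y} → x ≈ y → ev a x ≈ ev a y
    ev-cong a {x} {y} e =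
      Σ-cong (suc d) {λ j → a j * xⁿ x (toℕ j)} {λ j → a j * xⁿ y (toℕ j)} (λ j → *-congˡ (pow-cong (toℕ j) e))

    ev-coefficients : ∀ {a b} x → (∀ j → a j ≈ b j) → ev a x ≈ ev b x
    ev-coefficients {a} {b} x e =
      Σ-cong (suc d) {λ j → a j * xⁿ x (toℕ j)} {λ j → b j * xⁿ x (toℕ j)} (λ j → *-congʳ (e j))

  horner : ∀ d a x → evalPoly field' (suc d) a x ≈ a fzero + x * evalPoly field' d (λ j → a (fsuc j)) x
  horner d a x = begin
    a fzero * 1# + Σ (suc d) (λ j → a (fsuc j) * (x * xⁿ x (toℕ j)))
      ≈⟨ +-cong (*-identityʳ _) (Σ-cong (suc d) (λ j → solve 3 (λ a x p → a :* (x :* p) := x :* (a :* p))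
                                                            refl (a (fsuc j)) x (xⁿ x (toℕ j)))) ⟩
    a fzero + Σ (suc d) (λ j → x * (a (fsuc j) * xⁿ x (toℕ j)))
      ≈⟨ +-congˡ (Σ-scale (suc d) x (λ j → a (fsuc j) * xⁿ x (toℕ j))) ⟨
    a fzero + x * evalPoly field' d (λ j → a (fsuc j)) x ∎

  ev-constant : ∀ a x → evalPoly field' 0 a x ≈ a fzero
  ev-constant a x = trans (+-identityʳ _) (*-identityʳ _)

  ev-at-0 : ∀ d a → evalPoly field' d a 0# ≈ a fzero
  ev-at-0 zero a = ev-constant a 0#
  ev-at-0 (suc d) a = trans (horner d a 0#) (trans (+-congˡ (zeroˡ _)) (+-identityʳ _))

  ev-at-1 : ∀ d a → evalPoly field' d a 1# ≈ Σ (suc d) a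
  ev-at-1 d a = Σ-cong (suc d) (λ j → trans (*-congˡ (pow-1 (toℕ j))) (*-identityʳ (a j)))

module Positions {c ℓ : Level} {q : ℕ} (F : FiniteField c ℓ q) (d : ℕ) where
  open FieldFacts F
  open Evaluation F
  open Game field' d public
  open import Relation.Binary.Reasoning.Setoid setoid hiding (start)

  set-hit : ∀ pos i a → set pos i a i ≡ just a
  set-hit pos i a with i FinP.≟ i
  ... | yes _ = P.refl
  ... | no i≢i = ⊥-elim (i≢i P.refl)

  set-miss : ∀ pos i a j → i ≢ j → set pos i a j ≡ pos j
  set-miss pos i a j i≢j with i FinP.≟ j
  ... | yes i≡j = ⊥-elim (i≢j i≡j)
  ... | no _ = P.refl

  hole⇒incomplete : ∀ {pos} i → pos i ≡ nothing → ¬ Complete pos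
  hole⇒incomplete i hole complete with P.trans (P.sym hole) (proj₂ (complete i))
  ... | ()

  chosen⇒illegal : ∀ {pos i a b} → pos i ≡ just b → ¬ Legal pos i a
  chosen⇒illegal chosen (free , _) with P.trans (P.sym chosen) free
  ... | ()

  legal-middle : ∀ {pos i} a → pos i ≡ nothing → i ≢ fzero → toℕ i ≢ d → Legal pos i a
  legal-middle a free i≢0 i≢d =
    free , (λ i≡d → ⊥-elim (i≢d i≡d)) , (λ i≡0 → ⊥-elim (i≢0 (FinP.toℕ-injective i≡0)))

  -- the chosen value of an entry (0 for a hole)
  value : Maybe Carrier → Carrier
  value nothing = 0#
  value (just b) = b

  just-value : ∀ {p : Maybe Carrier} {b} → p ≡ just b → p ≡ just (value p)
  just-value P.refl = P.refl

  hole-or-chosen : (p : Maybe Carrier) → (p ≡ nothing) ⊎ (∃ λ b → p ≡ just b)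
  hole-or-chosen nothing = inj₁ P.refl
  hole-or-chosen (just b) = inj₂ (b , P.refl)

  OnlyHoleAt : Position → Fin (suc d) → Set c
  OnlyHoleAt pos i = ∀ j → i ≢ j → ∃ λ b → pos j ≡ just b

  ConstantNonzero : Position → Set (c ⊔ ℓ)
  ConstantNonzero pos = ∀ b → pos fzero ≡ just b → ¬ (b ≈ 0#)

  ConstantNonzero-set : ∀ pos i a → ConstantNonzero pos → Legal pos i a → ConstantNonzero (set pos i a)
  ConstantNonzero-set pos i a nz (_ , _ , legal-0) b e with i FinP.≟ fzero
  ... | yes P.refl = P.subst (λ b → ¬ (b ≈ 0#)) (MaybeP.just-injective e) (legal-0 P.refl)
  ... | no _ = nz b e

  Chosen : Position → (Fin (suc d) → Carrier) → Set c
  Chosen pos b = ∀ j → pos j ≡ just (b j)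

  chosen⇒complete : ∀ {pos b} → Chosen pos b → Complete pos
  chosen⇒complete {b = b} chosen j = b j , chosen j

  nora-wins-at : ∀ {pos} b → Chosen pos b → ¬ HasRoot field' d b → WinsAt Nora pos
  nora-wins-at b chosen no-root b′ chosen′ (x , root) =
    no-root (x , trans (ev-coefficients d x (λ j → reflexive (MaybeP.just-injective
                          (P.trans (P.sym (chosen j)) (chosen′ j))))) root)

  finalMove : ∀ {P pos} i a b → Legal pos i a → Chosen (set pos i a) b → WinsAt P (set pos i a) → Wins P P pos
  finalMove i a b legal chosen wins = myMove P.refl i a legal (finished (chosen⇒complete chosen) wins)

  wandaFinalMove : ∀ {pos} i a b → Legal pos i a → Chosen (set pos i a) b → HasRoot field' d b → Wins Wanda Wanda pos
  wandaFinalMove i a b legal chosen root = finalMove i a b legal chosen (b , chosen , root)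

  noraFinalMove : ∀ {pos} i a b → Legal pos i a → Chosen (set pos i a) b → ¬ HasRoot field' d b → Wins Nora Nora pos
  noraFinalMove i a b legal chosen no-root = finalMove i a b legal chosen (nora-wins-at b chosen no-root)

  noraMovesLast : ∀ {pos} i → pos i ≡ nothing → OnlyHoleAt pos i →
                  (∀ a → Legal pos i a → WinsAt Wanda (set pos i a)) → Wins Wanda Nora pos
  noraMovesLast {pos} i hole only wins = theirMove (λ ()) (hole⇒incomplete i hole) answer
    where
    answer : ∀ j a → Legal pos j a → Wins Wanda Wanda (set pos j a)
    answer j a legal with i FinP.≟ j
    ... | yes P.refl = finished complete (wins a legal)
      where
      complete : Complete (set pos i a)
      complete k with i FinP.≟ k
      ... | yes _ = a , P.refl
      ... | no i≢k = only k i≢k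
    ... | no i≢j = ⊥-elim (chosen⇒illegal {pos = pos} (proj₂ (only j i≢j)) legal)

  module OneHole {pos : Position} {i : Fin (suc d)} (hole : pos i ≡ nothing) (only : OnlyHoleAt pos i) where

    completion : Carrier → Fin (suc d) → Carrier
    completion a j = value (set pos i a j)

    completion-chosen : ∀ a → Chosen (set pos i a) (completion a)
    completion-chosen a j with i FinP.≟ j
    ... | yes _ = P.refl
    ... | no i≢j = just-value (proj₂ (only j i≢j))

    -- the polynomial formed by the chosen coefficients, i.e. f - aᵢ xⁱ
    rest : Carrier → Carrier
    rest = ev d (λ j → value (pos j))

    rest-cong : Congruent rest
    rest-cong = ev-cong d (λ j → value (pos j))

    split : ∀ a x → ev d (completion a) x ≈ a * xⁿ x (toℕ i) + rest x
    split a x = trans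
      (Σ-isolate (suc d) (λ j → completion a j * xⁿ x (toℕ j)) (λ j → value (pos j) * xⁿ x (toℕ j)) i
        (trans (*-congʳ (reflexive (P.cong value hole))) (zeroˡ _))
        (λ j i≢j → *-congʳ (reflexive (P.cong value (set-miss pos i a j i≢j)))))
      (+-congʳ (*-congʳ (reflexive (P.cong value (set-hit pos i a)))))

    -- Wanda choosing a middle coefficient makes 1 a root
    wandaFillsMiddle : i ≢ fzero → toℕ i ≢ d → Wins Wanda Wanda pos
    wandaFillsMiddle i≢0 i≢d =
      wandaFinalMove i a (completion a) (legal-middle {pos = pos} a hole i≢0 i≢d) (completion-chosen a) (1# , root-1)
      where
      a = - rest 1#
      root-1 : ev d (completion a) 1# ≈ 0#
      root-1 = begin
        ev d (completion a) 1#         ≈⟨ split a 1# ⟩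
        a * xⁿ 1# (toℕ i) + rest 1#    ≈⟨ +-congʳ (trans (*-congˡ (pow-1 (toℕ i))) (*-identityʳ a)) ⟩
        - rest 1# + rest 1#            ≈⟨ -‿inverseˡ _ ⟩
        0#                             ∎

    noraAvoids : i ≢ fzero → ConstantNonzero pos → ∀ a → Legal pos i a →
                 (∀ x → ¬ (x ≈ 0#) → ¬ (a + rest x * recip (xⁿ x (toℕ i)) ≈ 0#)) → Wins Nora Nora pos
    noraAvoids i≢0 a₀≉0 a legal avoids =
      noraFinalMove i a (completion a) legal (completion-chosen a) no-root
      where
      no-root : ¬ HasRoot field' d (completion a)
      no-root (x , root) with x ≟ 0#
      ... | yes x≈0 = a₀≉0 b (proj₂ (only fzero i≢0)) (begin
            b                              ≡⟨ P.cong value (P.sym (P.trans (set-miss pos i a fzero i≢0) (proj₂ (only fzero i≢0)))) ⟩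
            completion a fzero             ≈⟨ ev-at-0 d (completion a) ⟨
            ev d (completion a) 0#         ≈⟨ ev-cong d (completion a) x≈0 ⟨
            ev d (completion a) x          ≈⟨ root ⟩
            0#                             ∎)
        where b = proj₁ (only fzero i≢0)
      ... | no x≉0 = avoids x x≉0 (divide-out (pow-nonzero (toℕ i) x≉0) (trans (sym (split a x)) root))

    -- In the middle, Nora always finds such an a: the values
    -- -rest x / xⁱ (x ≉ 0) are fewer than the elements of F.
    noraFillsMiddle : i ≢ fzero → toℕ i ≢ d → ConstantNonzero pos → Wins Nora Nora pos
    noraFillsMiddle i≢0 i≢d a₀≉0 =
      noraAvoids i≢0 a₀≉0 a (legal-middle {pos = pos} a hole i≢0 i≢d)
        (λ x x≉0 e → proj₂ missed x x≉0 (sym (inverseˡ-unique a _ e)))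
      where
      k : Carrier → Carrier
      k x = - (rest x * recip (xⁿ x (toℕ i)))
      missed = nonzero-image-misses k (λ e → -‿cong (*-cong (rest-cong e) (recip-cong (pow-cong (toℕ i) e))))
      a = proj₁ missed

other-≢ : ∀ p → other p ≢ p
other-≢ Wanda ()
other-≢ Nora ()

other-involutive : ∀ p → other (other p) ≡ p
other-involutive Wanda = P.refl
other-involutive Nora = P.refl

mover-even : ∀ p m → mover p (m ℕ.* 2) ≡ p
mover-even p zero = P.refl
mover-even p (suc m) = P.trans (other-involutive _) (mover-even p m)

mover-odd : ∀ p m → mover p (suc (m ℕ.* 2)) ≡ other p
mover-odd p m = P.cong other (mover-even p m)

isHole : ∀ {a} {A : Set a} → Maybe A → ℕ
isHole nothing = 1
isHole (just _) = 0

holes : ∀ {a} {A : Set a} n → (Fin n → Maybe A) → ℕ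
holes zero p = 0
holes (suc n) p = isHole (p fzero) ℕ.+ holes n (λ j → p (fsuc j))

module _ {a} {A : Set a} where

  holes-cong : ∀ n {p p′ : Fin n → Maybe A} → (∀ j → p j ≡ p′ j) → holes n p ≡ holes n p′
  holes-cong zero e = P.refl
  holes-cong (suc n) e = P.cong₂ ℕ._+_ (P.cong isHole (e fzero)) (holes-cong n (λ j → e (fsuc j)))

  holes-fill : ∀ n (p p′ : Fin n → Maybe A) i → p i ≡ nothing → (∃ λ b → p′ i ≡ just b) →
               (∀ j → i ≢ j → p j ≡ p′ j) → holes n p ≡ suc (holes n p′)
  holes-fill (suc n) p p′ fzero hole (b , filled) same
    rewrite hole | filled = P.cong suc (holes-cong n (λ j → same (fsuc j) (λ ())))
  holes-fill (suc n) p p′ (fsuc i) hole filled same rewrite same fzero (λ ()) =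
    P.trans (P.cong (isHole (p′ fzero) ℕ.+_)
                    (holes-fill n (λ j → p (fsuc j)) (λ j → p′ (fsuc j)) i hole filled
                                (λ j i≢j → same (fsuc j) (λ e → i≢j (FinP.suc-injective e)))))
            (ℕP.+-suc _ _)

  some-hole : ∀ n (p : Fin n → Maybe A) k → holes n p ≡ suc k → ∃ λ j → p j ≡ nothing
  some-hole (suc n) p k e with p fzero in eq
  ... | nothing = fzero , eq
  ... | just _ = let (j , ej) = some-hole n (λ j → p (fsuc j)) k e in fsuc j , ej

  no-holes : ∀ n (p : Fin n → Maybe A) → holes n p ≡ 0 → ∀ j → ∃ λ b → p j ≡ just b
  no-holes (suc n) p e j with p fzero in eq
  no-holes (suc n) p e fzero | just b = b , eq
  no-holes (suc n) p e (fsuc j) | just b = no-holes n (λ j → p (fsuc j)) e j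

  all-holes : ∀ n → holes {A = A} n (λ _ → nothing) ≡ n
  all-holes zero = P.refl
  all-holes (suc n) = P.cong suc (all-holes n)

-- Degree d ≥ 4: the player making the last move wins by choosing the two
-- end coefficients a₀, a_d first (with value 1).  Having at least two
-- moves before the last one, that player can make sure both ends are
-- chosen before the end, so the last hole lies in the middle, where
-- OneHole.wandaFillsMiddle / noraFillsMiddle win.

module FillEndsFirst {c ℓ : Level} {q : ℕ} (F : FiniteField c ℓ q) (d : ℕ) (0≢d : fzero ≢ fromℕ d) where
  open FieldFacts F
  open Positions F d

  last : Fin (suc d)
  last = fromℕ d

  openEnds : Position → ℕ
  openEnds pos = isHole (pos fzero) ℕ.+ isHole (pos last)

  holes-set : ∀ pos i a → pos i ≡ nothing → holes (suc d) pos ≡ suc (holes (suc d) (set pos i a))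
  holes-set pos i a hole =
    holes-fill (suc d) pos (set pos i a) i hole (a , set-hit pos i a) (λ j i≢j → P.sym (set-miss pos i a j i≢j))

  isHole-set : ∀ pos i a j → isHole (set pos i a j) ≤ isHole (pos j)
  isHole-set pos i a j with i FinP.≟ j
  ... | yes _ = z≤n
  ... | no _ = ℕP.≤-refl

  openEnds-set : ∀ pos i a → openEnds (set pos i a) ≤ openEnds pos
  openEnds-set pos i a = ℕP.+-mono-≤ (isHole-set pos i a fzero) (isHole-set pos i a last)

  openEnds-fill-0 : ∀ pos a → pos fzero ≡ nothing → suc (openEnds (set pos fzero a)) ≡ openEnds pos
  openEnds-fill-0 pos a hole rewrite set-hit pos fzero a | set-miss pos fzero a last 0≢d | hole = P.refl

  openEnds-fill-last : ∀ pos a → pos last ≡ nothing → suc (openEnds (set pos last a)) ≡ openEnds pos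
  openEnds-fill-last pos a hole rewrite set-hit pos last a | set-miss pos last a fzero (λ e → 0≢d (P.sym e)) | hole =
    P.trans (P.cong suc (ℕP.+-identityʳ _)) (P.sym (ℕP.+-comm (isHole (pos fzero)) 1))

  last-hole-middle : ∀ pos i → pos i ≡ nothing → openEnds pos ≤ 0 → i ≢ fzero × toℕ i ≢ d
  last-hole-middle pos i hole ends≤0 = at-0 , at-d
    where
    at-0 : i ≢ fzero
    at-0 P.refl = ℕP.<-irrefl P.refl (ℕP.≤-trans (P.subst (λ k → 1 ≤ k ℕ.+ isHole (pos last))
                                                              (P.sym (P.cong isHole hole)) (s≤s z≤n)) ends≤0)
    at-d : toℕ i ≢ d
    at-d i≡d = ℕP.<-irrefl P.refl (ℕP.≤-trans (P.subst (λ k → 1 ≤ isHole (pos fzero) ℕ.+ k)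
                                                        (P.sym (P.cong isHole last-hole)) (ℕP.m≤n+m 1 _)) ends≤0)
      where
      last-hole : pos last ≡ nothing
      last-hole = P.subst (λ j → pos j ≡ nothing) (FinP.toℕ-injective (P.trans i≡d (P.sym (FinP.toℕ-fromℕ d)))) hole

  only-hole : ∀ pos i → holes (suc d) pos ≡ 1 → pos i ≡ nothing → OnlyHoleAt pos i
  only-hole pos i one hole j i≢j =
    let (b , e) = no-holes (suc d) (set pos i 0#) (ℕP.suc-injective (P.trans (P.sym (holes-set pos i 0# hole)) one)) j
    in b , P.trans (P.sym (set-miss pos i 0# j i≢j)) e

  next-move : ∀ m pos k → holes (suc d) pos ≡ suc k → openEnds pos ≤ suc m →
              ∃ λ j → pos j ≡ nothing × openEnds (set pos j 1#) ≤ m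
  next-move m pos k count ends with hole-or-chosen (pos fzero) | hole-or-chosen (pos last)
  ... | inj₁ e₀ | _ = fzero , e₀ , ℕP.≤-pred (P.subst (_≤ suc m) (P.sym (openEnds-fill-0 pos 1# e₀)) ends)
  ... | inj₂ _ | inj₁ e_d = last , e_d , ℕP.≤-pred (P.subst (_≤ suc m) (P.sym (openEnds-fill-last pos 1# e_d)) ends)
  ... | inj₂ (_ , e₀) | inj₂ (_ , e_d) =
    j , hole , ℕP.≤-trans (openEnds-set pos j 1#) (P.subst (_≤ m) (P.sym none-open) z≤n)
    where
    j = proj₁ (some-hole (suc d) pos k count)
    hole = proj₂ (some-hole (suc d) pos k count)
    none-open : openEnds pos ≡ 0
    none-open rewrite e₀ | e_d = P.refl

  legal-1 : ∀ pos j → pos j ≡ nothing → Legal pos j 1#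
  legal-1 pos j hole = hole , (λ _ → 1≉0) , (λ _ → 1≉0)

  FinalMove : Player → Set (c ⊔ ℓ)
  FinalMove P = ∀ pos i → pos i ≡ nothing → OnlyHoleAt pos i → i ≢ fzero → toℕ i ≢ d →
                ConstantNonzero pos → Wins P P pos

  middleFinish : ∀ P → FinalMove P
  middleFinish Wanda pos i hole only i≢0 i≢d _ = OneHole.wandaFillsMiddle hole only i≢0 i≢d
  middleFinish Nora pos i hole only i≢0 i≢d a₀≉0 = OneHole.noraFillsMiddle hole only i≢0 i≢d a₀≉0

  -- P's strategy: with 2m + 1 holes left and P to move, or 2m + 2 holes
  -- left and the opponent to move, at most m ends may be open.
  module Strategy (P : Player) where
    mine : ∀ m pos → holes (suc d) pos ≡ suc (m ℕ.* 2) → openEnds pos ≤ m → ConstantNonzero pos → Wins P P pos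
    theirs : ∀ m pos → holes (suc d) pos ≡ suc (suc (m ℕ.* 2)) → openEnds pos ≤ m → ConstantNonzero pos →
             Wins P (other P) pos

    mine zero pos count ends a₀≉0 =
      middleFinish P pos i hole (only-hole pos i count hole) i≢0 i≢d a₀≉0
      where
      i = proj₁ (some-hole (suc d) pos 0 count)
      hole = proj₂ (some-hole (suc d) pos 0 count)
      i≢0 = proj₁ (last-hole-middle pos i hole ends)
      i≢d = proj₂ (last-hole-middle pos i hole ends)
    mine (suc m) pos count ends a₀≉0 =
      let (j , hole , ends′) = next-move m pos _ count ends
      in myMove P.refl j 1# (legal-1 pos j hole)
           (theirs m (set pos j 1#) (ℕP.suc-injective (P.trans (P.sym (holes-set pos j 1# hole)) count)) ends′
                   (ConstantNonzero-set pos j 1# a₀≉0 (legal-1 pos j hole)))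

    theirs m pos count ends a₀≉0 = theirMove (other-≢ P) (hole⇒incomplete i hole) reply
      where
      i = proj₁ (some-hole (suc d) pos _ count)
      hole = proj₂ (some-hole (suc d) pos _ count)
      reply : ∀ j a → Legal pos j a → Wins P (other (other P)) (set pos j a)
      reply j a legal = P.subst (λ t → Wins P t (set pos j a)) (P.sym (other-involutive P))
        (mine m (set pos j a) (ℕP.suc-injective (P.trans (P.sym (holes-set pos j a (proj₁ legal))) count))
              (ℕP.≤-trans (openEnds-set pos j a) ends) (ConstantNonzero-set pos j a a₀≉0 legal))

parity : ∀ n → ∃ λ m → (n ≡ m ℕ.* 2) ⊎ (n ≡ suc (m ℕ.* 2))
parity zero = 0 , inj₁ P.refl
parity (suc n) with parity n
... | m , inj₁ e = m , inj₂ (P.cong suc e)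
... | m , inj₂ e = suc m , inj₁ (P.cong suc e)

half-≥2 : ∀ m → 4 ≤ suc (m ℕ.* 2) → 2 ≤ m
half-≥2 (suc (suc m)) _ = s≤s (s≤s z≤n)
half-≥2 (suc zero) (s≤s (s≤s (s≤s ())))
half-≥2 zero (s≤s ())

-- Part (1) for d ≥ 4: with d + 1 = 2m + 1 moves the last mover is
-- Player I, with d + 1 = 2m + 2 moves it is Player II; either way m ≥ 2.
last-mover-wins-≥4 : ∀ {c ℓ q} (F : FiniteField c ℓ q) d → 4 ≤ d → ∀ p →
                     Game.Wins (FiniteField.field' F) d (mover p d) p (Game.start (FiniteField.field' F) d)
last-mover-wins-≥4 F zero () p
last-mover-wins-≥4 F (suc d′) 4≤d p with parity (suc d′)
... | m , inj₁ even = P.subst (λ t → Wins (mover p d) t start) (P.trans (P.cong (mover p) even) (mover-even p m))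
    (mine m start (P.trans (all-holes (suc d)) (P.cong suc even))
          (half-≥2 m (ℕP.≤-trans 4≤d (P.subst (_≤ suc (m ℕ.* 2)) (P.sym even) (ℕP.n≤1+n _)))) λ _ ())
  where
  d = suc d′
  open Positions F d
  open FillEndsFirst F d (λ ())
  open Strategy (mover p d)
... | m , inj₂ odd = P.subst (λ t → Wins (mover p d) t start) last≡other
    (theirs m start (P.trans (all-holes (suc d)) (P.cong suc odd))
            (half-≥2 m (P.subst (4 ≤_) odd 4≤d)) λ _ ())
  where
  d = suc d′
  open Positions F d
  open FillEndsFirst F d (λ ())
  open Strategy (mover p d)
  last≡other : other (mover p d) ≡ p
  last≡other = P.trans (P.cong other (P.trans (P.cong (mover p) odd) (mover-odd p m))) (other-involutive p)

module DegreeThree {c ℓ : Level} {q : ℕ} (F : FiniteField c ℓ q) where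
  open FieldFacts F
  open Evaluation F
  open LowDegreeMaps F
  open Positions F 3
  open import Relation.Binary.Reasoning.Setoid setoid hiding (start)

  i0 i1 i2 i3 : Fin 4
  i0 = fzero
  i1 = fsuc fzero
  i2 = fsuc (fsuc fzero)
  i3 = fsuc (fsuc (fsuc fzero))

  coeffs : Carrier → Carrier → Carrier → Carrier → Fin 4 → Carrier
  coeffs a0 a1 a2 a3 fzero = a0
  coeffs a0 a1 a2 a3 (fsuc fzero) = a1
  coeffs a0 a1 a2 a3 (fsuc (fsuc fzero)) = a2
  coeffs a0 a1 a2 a3 (fsuc (fsuc (fsuc fzero))) = a3

  ev-cubic : ∀ a x → ev 3 a x ≈ a i0 + cubic (a i1) (a i2) (a i3) x
  ev-cubic a x =
    trans (horner 2 a x) (+-congˡ (*-congˡ (trans (horner 1 (λ j → a (fsuc j)) x) (+-congˡ (*-congˡ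
      (trans (horner 0 (λ j → a (fsuc (fsuc j))) x) (+-congˡ (*-congˡ (ev-constant (λ j → a (fsuc (fsuc (fsuc j)))) x)))))))))

  ev-reversed : ∀ a x u → x * u ≈ 1# → ev 3 a x ≈ x * (x * x) * (a i3 + cubic (a i2) (a i1) (a i0) u)
  ev-reversed a x u xu≈1 = sym (begin
    x * (x * x) * (a3 + cubic a2 a1 a0 u) ≈⟨ solve 6 (λ a0 a1 a2 a3 x u →
                                              (x :* (x :* x)) :* (a3 :+ u :* (a2 :+ u :* (a1 :+ u :* a0)))
                                              := a3 :* (x :* (x :* x)) :+ a2 :* (x :* x) :* (x :* u)
                                                   :+ a1 :* x :* ((x :* u) :* (x :* u))
                                                   :+ a0 :* ((x :* u) :* ((x :* u) :* (x :* u)))) refl a0 a1 a2 a3 x u ⟩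
    T (x * u)                             ≈⟨ T-cong xu≈1 ⟩
    T 1#                                  ≈⟨ solve 5 (λ a0 a1 a2 a3 x →
                                              a3 :* (x :* (x :* x)) :+ a2 :* (x :* x) :* con (+ 1)
                                                :+ a1 :* x :* (con (+ 1) :* con (+ 1))
                                                :+ a0 :* (con (+ 1) :* (con (+ 1) :* con (+ 1)))
                                              := a0 :+ x :* (a1 :+ x :* (a2 :+ x :* a3))) refl a0 a1 a2 a3 x ⟩
    a0 + cubic a1 a2 a3 x                 ≈⟨ ev-cubic a x ⟨
    ev 3 a x                              ∎)
    where
    a0 = a i0
    a1 = a i1
    a2 = a i2
    a3 = a i3
    -- x³ (a₃ + a₂u + a₁u² + a₀u³) written in terms of k = x u
    T : Carrier → Carrier
    T k = a3 * (x * (x * x)) + a2 * (x * x) * k + a1 * x * (k * k) + a0 * (k * (k * k))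
    T-cong : Congruent T
    T-cong e = +-cong (+-cong (+-congˡ (*-congˡ e)) (*-congˡ (*-cong e e))) (*-congˡ (*-cong e (*-cong e e)))

  pairs-cancel : ∀ a → a i0 + a i3 ≈ 0# → a i1 + a i2 ≈ 0# → ev 3 a 1# ≈ 0#
  pairs-cancel a ends middles = begin
    ev 3 a 1#                                   ≈⟨ ev-at-1 3 a ⟩
    a i0 + (a i1 + (a i2 + (a i3 + 0#)))        ≈⟨ solve 4 (λ a0 a1 a2 a3 → a0 :+ (a1 :+ (a2 :+ (a3 :+ con (+ 0))))
                                                      := (a0 :+ a3) :+ (a1 :+ a2)) refl (a i0) (a i1) (a i2) (a i3) ⟩
    (a i0 + a i3) + (a i1 + a i2)               ≈⟨ +-cong ends middles ⟩
    0# + 0#                                     ≈⟨ +-identityʳ 0# ⟩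
    0#                                          ∎

  -- The last hole is a₀ or a₃, and
  -- the outcome depends on whether u ↦ a₁u + a₂u² + a₃u³ (resp. its
  -- reversal u ↦ a₂u + a₁u² + a₀u³, via x = 1/u) is injective.
  module _ {pos : Position} {a1 a2 : Carrier} (e1 : pos i1 ≡ just a1) (e2 : pos i2 ≡ just a2) where

    noraChoosesConstant : ∀ {a3} → pos i0 ≡ nothing → pos i3 ≡ just a3 → Collision (cubic a1 a2 a3) → Wins Nora Nora pos
    noraChoosesConstant {a3} hole e3 collision =
      noraFinalMove i0 v b (hole , (λ ()) , (λ _ → v≉0)) chosen no-root
      where
      avoidable = collision⇒avoidable (cubic a1 a2 a3) (cubic-cong a1 a2 a3) (cubic-0 a1 a2 a3) collision
      v = proj₁ avoidable
      v≉0 = proj₁ (proj₂ avoidable)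
      b = coeffs v a1 a2 a3
      chosen : Chosen (set pos i0 v) b
      chosen = λ { fzero → P.refl ; (fsuc fzero) → e1 ; (fsuc (fsuc fzero)) → e2 ; (fsuc (fsuc (fsuc fzero))) → e3 }
      no-root : ¬ HasRoot field' 3 b
      no-root (x , root) = proj₂ (proj₂ avoidable) x (trans (sym (ev-cubic b x)) root)

    noraChoosesLeading : ∀ {a0} → pos i3 ≡ nothing → pos i0 ≡ just a0 → ¬ (a0 ≈ 0#) →
                         Collision (cubic a2 a1 a0) → Wins Nora Nora pos
    noraChoosesLeading {a0} hole e0 a0≉0 collision =
      noraFinalMove i3 v b (hole , (λ _ → v≉0) , (λ ())) chosen no-root
      where
      avoidable = collision⇒avoidable (cubic a2 a1 a0) (cubic-cong a2 a1 a0) (cubic-0 a2 a1 a0) collision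
      v = proj₁ avoidable
      v≉0 = proj₁ (proj₂ avoidable)
      b = coeffs a0 a1 a2 v
      chosen : Chosen (set pos i3 v) b
      chosen = λ { fzero → e0 ; (fsuc fzero) → e1 ; (fsuc (fsuc fzero)) → e2 ; (fsuc (fsuc (fsuc fzero))) → P.refl }
      no-root : ¬ HasRoot field' 3 b
      no-root (x , root) with x ≟ 0#
      ... | yes x≈0 = a0≉0 (trans (sym (ev-at-0 3 b)) (trans (ev-cong 3 b (sym x≈0)) root))
      ... | no x≉0 = proj₂ (proj₂ avoidable) (recip x)
          (zero-product (trans (sym (ev-reversed b x (recip x) (recip-inverse x≉0))) root)
                        (*-nonzero x≉0 (*-nonzero x≉0 x≉0)))

    wandaAnswersConstant : ∀ {a3} → pos i0 ≡ nothing → pos i3 ≡ just a3 → Injective (cubic a1 a2 a3) → Wins Wanda Nora pos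
    wandaAnswersConstant {a3} hole e3 injective = noraMovesLast i0 hole only root
      where
      only : OnlyHoleAt pos i0
      only = λ { fzero 0≢0 → ⊥-elim (0≢0 P.refl) ; (fsuc fzero) _ → a1 , e1
               ; (fsuc (fsuc fzero)) _ → a2 , e2 ; (fsuc (fsuc (fsuc fzero))) _ → a3 , e3 }
      root : ∀ v → Legal pos i0 v → WinsAt Wanda (set pos i0 v)
      root v _ = coeffs v a1 a2 a3
               , (λ { fzero → P.refl ; (fsuc fzero) → e1 ; (fsuc (fsuc fzero)) → e2 ; (fsuc (fsuc (fsuc fzero))) → e3 })
               , z , trans (ev-cubic (coeffs v a1 a2 a3) z) v+h[z]≈0
        where
        z = proj₁ (injective⇒solvable (cubic a1 a2 a3) (cubic-cong a1 a2 a3) injective v)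
        v+h[z]≈0 = proj₂ (injective⇒solvable (cubic a1 a2 a3) (cubic-cong a1 a2 a3) injective v)

    wandaAnswersLeading : ∀ {a0} → pos i3 ≡ nothing → pos i0 ≡ just a0 → Injective (cubic a2 a1 a0) → Wins Wanda Nora pos
    wandaAnswersLeading {a0} hole e0 injective = noraMovesLast i3 hole only root
      where
      only : OnlyHoleAt pos i3
      only = λ { fzero _ → a0 , e0 ; (fsuc fzero) _ → a1 , e1 ; (fsuc (fsuc fzero)) _ → a2 , e2
               ; (fsuc (fsuc (fsuc fzero))) 3≢3 → ⊥-elim (3≢3 P.refl) }
      root : ∀ v → Legal pos i3 v → WinsAt Wanda (set pos i3 v)
      root v (_ , v≉0 , _) = coeffs a0 a1 a2 v
               , (λ { fzero → e0 ; (fsuc fzero) → e1 ; (fsuc (fsuc fzero)) → e2 ; (fsuc (fsuc (fsuc fzero))) → P.refl })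
               , recip z , (begin
                 ev 3 b (recip z)                                   ≈⟨ ev-reversed b (recip z) z (trans (*-comm _ _) (recip-inverse z≉0)) ⟩
                 recip z * (recip z * recip z) * (v + cubic a2 a1 a0 z) ≈⟨ *-congˡ v+h[z]≈0 ⟩
                 recip z * (recip z * recip z) * 0#                 ≈⟨ zeroʳ _ ⟩
                 0#                                                 ∎)
        where
        b = coeffs a0 a1 a2 v
        z = proj₁ (injective⇒solvable (cubic a2 a1 a0) (cubic-cong a2 a1 a0) injective v)
        v+h[z]≈0 = proj₂ (injective⇒solvable (cubic a2 a1 a0) (cubic-cong a2 a1 a0) injective v)
        -- z ≉ 0, since a₃ = v ≉ 0
        z≉0 : ¬ (z ≈ 0#)
        z≉0 z≈0 = v≉0 P.refl (trans (sym (+-identityʳ v))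
                               (trans (+-congˡ (sym (trans (cubic-cong a2 a1 a0 z≈0) (cubic-0 a2 a1 a0)))) v+h[z]≈0))

  -- Nora moves first (Wanda last): Wanda answers each move in one of the
  -- pairs {a₀, a₃}, {a₁, a₂} by the opposite value on the other member of
  -- the pair, so that f(1) = (a₀ + a₃) + (a₁ + a₂) = 0.
  module Pairing where
    middlesLeft : ∀ {pos a0 a3} → pos i0 ≡ just a0 → pos i3 ≡ just a3 → pos i1 ≡ nothing → pos i2 ≡ nothing →
                  a0 + a3 ≈ 0# → Wins Wanda Nora pos
    middlesLeft {pos} {a0} {a3} e0 e3 h1 h2 ends = theirMove (λ ()) (hole⇒incomplete i1 h1) answer
      where
      answer : ∀ j w → Legal pos j w → Wins Wanda Wanda (set pos j w)
      answer (fsuc fzero) w _ =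
        wandaFinalMove i2 (- w) b (legal-middle {pos = set pos i1 w} (- w) h2 (λ ()) (λ ()))
          (λ { fzero → e0 ; (fsuc fzero) → P.refl ; (fsuc (fsuc fzero)) → P.refl ; (fsuc (fsuc (fsuc fzero))) → e3 })
          (1# , pairs-cancel b ends (-‿inverseʳ w))
        where b = coeffs a0 w (- w) a3
      answer (fsuc (fsuc fzero)) w _ =
        wandaFinalMove i1 (- w) b (legal-middle {pos = set pos i2 w} (- w) h1 (λ ()) (λ ()))
          (λ { fzero → e0 ; (fsuc fzero) → P.refl ; (fsuc (fsuc fzero)) → P.refl ; (fsuc (fsuc (fsuc fzero))) → e3 })
          (1# , pairs-cancel b ends (-‿inverseˡ w))
        where b = coeffs a0 (- w) w a3
      answer fzero w legal = ⊥-elim (chosen⇒illegal {pos = pos} e0 legal)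
      answer (fsuc (fsuc (fsuc fzero))) w legal = ⊥-elim (chosen⇒illegal {pos = pos} e3 legal)

    endsLeft : ∀ {pos a1 a2} → pos i1 ≡ just a1 → pos i2 ≡ just a2 → pos i0 ≡ nothing → pos i3 ≡ nothing →
               a1 + a2 ≈ 0# → Wins Wanda Nora pos
    endsLeft {pos} {a1} {a2} e1 e2 h0 h3 middles = theirMove (λ ()) (hole⇒incomplete i0 h0) answer
      where
      answer : ∀ j v → Legal pos j v → Wins Wanda Wanda (set pos j v)
      answer fzero v (_ , _ , v≉0) =
        wandaFinalMove i3 (- v) b (h3 , (λ _ → -‿nonzero (v≉0 P.refl)) , (λ ()))
          (λ { fzero → P.refl ; (fsuc fzero) → e1 ; (fsuc (fsuc fzero)) → e2 ; (fsuc (fsuc (fsuc fzero))) → P.refl })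
          (1# , pairs-cancel b (-‿inverseʳ v) middles)
        where b = coeffs v a1 a2 (- v)
      answer (fsuc (fsuc (fsuc fzero))) v (_ , v≉0 , _) =
        wandaFinalMove i0 (- v) b (h0 , (λ ()) , (λ _ → -‿nonzero (v≉0 P.refl)))
          (λ { fzero → P.refl ; (fsuc fzero) → e1 ; (fsuc (fsuc fzero)) → e2 ; (fsuc (fsuc (fsuc fzero))) → P.refl })
          (1# , pairs-cancel b (-‿inverseˡ v) middles)
        where b = coeffs (- v) a1 a2 v
      answer (fsuc fzero) v legal = ⊥-elim (chosen⇒illegal {pos = pos} e1 legal)
      answer (fsuc (fsuc fzero)) v legal = ⊥-elim (chosen⇒illegal {pos = pos} e2 legal)

    wandaWins : Wins Wanda Nora start
    wandaWins = theirMove (λ ()) (hole⇒incomplete i0 P.refl) answer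
      where
      answer : ∀ i v → Legal start i v → Wins Wanda Wanda (set start i v)
      answer fzero v (_ , _ , v≉0) = myMove P.refl i3 (- v) (P.refl , (λ _ → -‿nonzero (v≉0 P.refl)) , (λ ()))
        (middlesLeft P.refl P.refl P.refl P.refl (-‿inverseʳ v))
      answer (fsuc (fsuc (fsuc fzero))) v (_ , v≉0 , _) = myMove P.refl i0 (- v) (P.refl , (λ ()) , (λ _ → -‿nonzero (v≉0 P.refl)))
        (middlesLeft P.refl P.refl P.refl P.refl (-‿inverseˡ v))
      answer (fsuc fzero) v _ = myMove P.refl i2 (- v) (legal-middle {pos = set start i1 v} (- v) P.refl (λ ()) (λ ()))
        (endsLeft P.refl P.refl P.refl P.refl (-‿inverseʳ v))
      answer (fsuc (fsuc fzero)) v _ = myMove P.refl i1 (- v) (legal-middle {pos = set start i2 v} (- v) P.refl (λ ()) (λ ()))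
        (endsLeft P.refl P.refl P.refl P.refl (-‿inverseˡ v))

  module NoraLast (3≉0 : ¬ (N 3 ≈ 0#)) where
    -- both ends chosen (a₀ ≉ 0): the last hole will be in the middle
    middlesLeft : ∀ {pos a0 a3} → pos i0 ≡ just a0 → pos i3 ≡ just a3 → pos i1 ≡ nothing → pos i2 ≡ nothing →
                  ¬ (a0 ≈ 0#) → Wins Nora Wanda pos
    middlesLeft {pos} {a0} {a3} e0 e3 h1 h2 a0≉0 = theirMove (λ ()) (hole⇒incomplete i1 h1) answer
      where
      a₀≉0 : ∀ pos′ → pos′ i0 ≡ just a0 → ConstantNonzero pos′
      a₀≉0 pos′ e b e′ = P.subst (λ b → ¬ (b ≈ 0#)) (MaybeP.just-injective (P.trans (P.sym e) e′)) a0≉0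
      answer : ∀ j w → Legal pos j w → Wins Nora Nora (set pos j w)
      answer (fsuc fzero) w _ = OneHole.noraFillsMiddle {pos = set pos i1 w} h2
        (λ { fzero _ → a0 , e0 ; (fsuc fzero) _ → w , P.refl ; (fsuc (fsuc fzero)) 2≢2 → ⊥-elim (2≢2 P.refl)
           ; (fsuc (fsuc (fsuc fzero))) _ → a3 , e3 })
        (λ ()) (λ ()) (a₀≉0 (set pos i1 w) e0)
      answer (fsuc (fsuc fzero)) w _ = OneHole.noraFillsMiddle {pos = set pos i2 w} h1
        (λ { fzero _ → a0 , e0 ; (fsuc fzero) 1≢1 → ⊥-elim (1≢1 P.refl) ; (fsuc (fsuc fzero)) _ → w , P.refl
           ; (fsuc (fsuc (fsuc fzero))) _ → a3 , e3 })
        (λ ()) (λ ()) (a₀≉0 (set pos i2 w) e0)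
      answer fzero w legal = ⊥-elim (chosen⇒illegal {pos = pos} e0 legal)
      answer (fsuc (fsuc (fsuc fzero))) w legal = ⊥-elim (chosen⇒illegal {pos = pos} e3 legal)

    -- exactly one middle coefficient is zero: whichever end Wanda chooses,
    -- the resulting cubic map identifies two points
    endsLeft : ∀ {pos a1 a2} → pos i1 ≡ just a1 → pos i2 ≡ just a2 → pos i0 ≡ nothing → pos i3 ≡ nothing →
               OneZero a1 a2 → Wins Nora Wanda pos
    endsLeft {pos} {a1} {a2} e1 e2 h0 h3 one-zero = theirMove (λ ()) (hole⇒incomplete i0 h0) answer
      where
      answer : ∀ j v → Legal pos j v → Wins Nora Nora (set pos j v)
      answer fzero v (_ , _ , v≉0) =
        noraChoosesLeading e1 e2 h3 P.refl (v≉0 P.refl) (cubic-collision 3≉0 (OneZero-sym one-zero) (v≉0 P.refl))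
      answer (fsuc (fsuc (fsuc fzero))) v (_ , v≉0 , _) =
        noraChoosesConstant e1 e2 h0 P.refl (cubic-collision 3≉0 one-zero (v≉0 P.refl))
      answer (fsuc fzero) v legal = ⊥-elim (chosen⇒illegal {pos = pos} e1 legal)
      answer (fsuc (fsuc fzero)) v legal = ⊥-elim (chosen⇒illegal {pos = pos} e2 legal)

    -- Nora answers an end by the other end (value 1), a middle v by the
    -- other middle with exactly one of the two zero
    noraWins : Wins Nora Wanda start
    noraWins = theirMove (λ ()) (hole⇒incomplete i0 P.refl) answer
      where
      answer : ∀ i v → Legal start i v → Wins Nora Nora (set start i v)
      answer fzero v (_ , _ , v≉0) = myMove P.refl i3 1# (P.refl , (λ _ → 1≉0) , (λ ()))
        (middlesLeft P.refl P.refl P.refl P.refl (v≉0 P.refl))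
      answer (fsuc (fsuc (fsuc fzero))) v _ = myMove P.refl i0 1# (P.refl , (λ ()) , (λ _ → 1≉0))
        (middlesLeft P.refl P.refl P.refl P.refl 1≉0)
      answer (fsuc fzero) v _ = myMove P.refl i2 w (legal-middle {pos = set start i1 v} w P.refl (λ ()) (λ ()))
        (endsLeft P.refl P.refl P.refl P.refl (proj₂ (complement v)))
        where w = proj₁ (complement v)
      answer (fsuc (fsuc fzero)) v _ = myMove P.refl i1 w (legal-middle {pos = set start i2 v} w P.refl (λ ()) (λ ()))
        (endsLeft P.refl P.refl P.refl P.refl (OneZero-sym (proj₂ (complement v))))
        where w = proj₁ (complement v)

  -- Wanda moves first, characteristic 3: Wanda plays a₁ = 0 and then makes
  -- the cubic part injective, so Nora's last choice always leaves a root.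
  module WandaFirstChar3 (3≈0 : N 3 ≈ 0#) where
    wandaWins : Wins Wanda Wanda start
    wandaWins = myMove P.refl i1 0# (legal-middle {pos = start} 0# P.refl (λ ()) (λ ())) (theirMove (λ ()) (hole⇒incomplete i0 P.refl) answer)
      where
      answer : ∀ j v → Legal (set start i1 0#) j v → Wins Wanda Wanda (set (set start i1 0#) j v)
      -- a₀ = c: a₂ := 0 leaves c u³, injective in characteristic 3
      answer fzero c (_ , _ , c≉0) = myMove P.refl i2 0# (legal-middle {pos = set (set start i1 0#) i0 c} 0# P.refl (λ ()) (λ ()))
        (wandaAnswersLeading P.refl P.refl P.refl P.refl (cube-injective-char3 3≈0 (c≉0 P.refl)))
      -- a₃ = e: a₂ := 0 leaves e u³
      answer (fsuc (fsuc (fsuc fzero))) e (_ , e≉0 , _) = myMove P.refl i2 0# (legal-middle {pos = set (set start i1 0#) i3 e} 0# P.refl (λ ()) (λ ()))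
        (wandaAnswersConstant P.refl P.refl P.refl P.refl (cube-injective-char3 3≈0 (e≉0 P.refl)))
      -- a₂ = w: a₀ := C with -w/C not a nonzero square makes w u + C u³ injective
      answer (fsuc (fsuc fzero)) w _ = myMove P.refl i0 C (P.refl , (λ ()) , (λ _ → C≉0))
        (wandaAnswersLeading P.refl P.refl P.refl P.refl (cubic-injective-char3 3≈0 w 0# C refl no-root))
        where
        choice = nonsquare-coefficient (char3⇒2≉0 3≈0) w
        C = proj₁ choice
        C≉0 = proj₁ (proj₂ choice)
        no-root = proj₂ (proj₂ choice)
      answer (fsuc fzero) _ legal = ⊥-elim (chosen⇒illegal {pos = set start i1 0#} P.refl legal)

-- Degree 2.  The last move is made by Player I, who starts with a₁.

module DegreeTwo {c ℓ : Level} {q : ℕ} (F : FiniteField c ℓ q) where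
  open FieldFacts F
  open Evaluation F
  open LowDegreeMaps F
  open Positions F 2
  open import Relation.Binary.Reasoning.Setoid setoid hiding (start)

  i0 i1 i2 : Fin 3
  i0 = fzero
  i1 = fsuc fzero
  i2 = fsuc (fsuc fzero)

  coeffs : Carrier → Carrier → Carrier → Fin 3 → Carrier
  coeffs a0 a1 a2 fzero = a0
  coeffs a0 a1 a2 (fsuc fzero) = a1
  coeffs a0 a1 a2 (fsuc (fsuc fzero)) = a2

  ev-quadratic : ∀ a x → ev 2 a x ≈ a i0 + quadratic (a i1) (a i2) x
  ev-quadratic a x =
    trans (horner 1 a x) (+-congˡ (*-congˡ (trans (horner 0 (λ j → a (fsuc j)) x)
      (+-congˡ (*-congˡ (ev-constant (λ j → a (fsuc (fsuc j))) x))))))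

  ev-reversed : ∀ a x u → x * u ≈ 1# → ev 2 a x ≈ x * x * (a i2 + quadratic (a i1) (a i0) u)
  ev-reversed a x u xu≈1 = sym (begin
    x * x * (a2 + quadratic a1 a0 u)  ≈⟨ solve 5 (λ a0 a1 a2 x u → (x :* x) :* (a2 :+ u :* (a1 :+ u :* a0))
                                          := a2 :* (x :* x) :+ a1 :* x :* (x :* u) :+ a0 :* ((x :* u) :* (x :* u)))
                                          refl a0 a1 a2 x u ⟩
    T (x * u)                         ≈⟨ T-cong xu≈1 ⟩
    T 1#                              ≈⟨ solve 4 (λ a0 a1 a2 x → a2 :* (x :* x) :+ a1 :* x :* con (+ 1) :+ a0 :* (con (+ 1) :* con (+ 1))
                                          := a0 :+ x :* (a1 :+ x :* a2)) refl a0 a1 a2 x ⟩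
    a0 + quadratic a1 a2 x            ≈⟨ ev-quadratic a x ⟨
    ev 2 a x                          ∎)
    where
    a0 = a i0
    a1 = a i1
    a2 = a i2
    -- x² (a₂ + a₁u + a₀u²) written in terms of k = x u
    T : Carrier → Carrier
    T k = a2 * (x * x) + a1 * x * k + a0 * (k * k)
    T-cong : Congruent T
    T-cong e = +-cong (+-congˡ (*-congˡ e)) (*-congˡ (*-cong e e))

  -- Wanda moves first: a₁ := 0, then she answers an end v by -v on the
  -- other end, so f(1) = 0.
  wandaWins : Wins Wanda Wanda start
  wandaWins = myMove P.refl i1 0# (legal-middle {pos = start} 0# P.refl (λ ()) (λ ()))
                (theirMove (λ ()) (hole⇒incomplete i0 P.refl) answer)
    where
    f[1]≈0 : ∀ a → a i0 + a i2 ≈ 0# → a i1 ≈ 0# → ev 2 a 1# ≈ 0#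
    f[1]≈0 a ends middle = begin
      ev 2 a 1#                      ≈⟨ ev-at-1 2 a ⟩
      a i0 + (a i1 + (a i2 + 0#))    ≈⟨ solve 3 (λ a0 a1 a2 → a0 :+ (a1 :+ (a2 :+ con (+ 0))) := (a0 :+ a2) :+ a1)
                                          refl (a i0) (a i1) (a i2) ⟩
      (a i0 + a i2) + a i1           ≈⟨ +-cong ends middle ⟩
      0# + 0#                        ≈⟨ +-identityʳ 0# ⟩
      0#                             ∎
    answer : ∀ j v → Legal (set start i1 0#) j v → Wins Wanda Wanda (set (set start i1 0#) j v)
    answer fzero v (_ , _ , v≉0) =
      wandaFinalMove i2 (- v) (coeffs v 0# (- v)) (P.refl , (λ _ → -‿nonzero (v≉0 P.refl)) , (λ ()))
        (λ { fzero → P.refl ; (fsuc fzero) → P.refl ; (fsuc (fsuc fzero)) → P.refl })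
        (1# , f[1]≈0 (coeffs v 0# (- v)) (-‿inverseʳ v) refl)
    answer (fsuc (fsuc fzero)) v (_ , v≉0 , _) =
      wandaFinalMove i0 (- v) (coeffs (- v) 0# v) (P.refl , (λ ()) , (λ _ → -‿nonzero (v≉0 P.refl)))
        (λ { fzero → P.refl ; (fsuc fzero) → P.refl ; (fsuc (fsuc fzero)) → P.refl })
        (1# , f[1]≈0 (coeffs (- v) 0# v) (-‿inverseˡ v) refl)
    answer (fsuc fzero) _ legal = ⊥-elim (chosen⇒illegal {pos = set start i1 0#} P.refl legal)

  module _ {pos : Position} {a1 : Carrier} (e1 : pos i1 ≡ just a1) where

    noraChoosesConstant : ∀ {a2} → pos i0 ≡ nothing → pos i2 ≡ just a2 → Collision (quadratic a1 a2) → Wins Nora Nora pos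
    noraChoosesConstant {a2} hole e2 collision =
      noraFinalMove i0 v b (hole , (λ ()) , (λ _ → v≉0))
        (λ { fzero → P.refl ; (fsuc fzero) → e1 ; (fsuc (fsuc fzero)) → e2 }) no-root
      where
      avoidable = collision⇒avoidable (quadratic a1 a2) (quadratic-cong a1 a2) (zeroˡ _) collision
      v = proj₁ avoidable
      v≉0 = proj₁ (proj₂ avoidable)
      b = coeffs v a1 a2
      no-root : ¬ HasRoot field' 2 b
      no-root (x , root) = proj₂ (proj₂ avoidable) x (trans (sym (ev-quadratic b x)) root)

    noraChoosesLeading : ∀ {a0} → pos i2 ≡ nothing → pos i0 ≡ just a0 → ¬ (a0 ≈ 0#) →
                         Collision (quadratic a1 a0) → Wins Nora Nora pos
    noraChoosesLeading {a0} hole e0 a0≉0 collision =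
      noraFinalMove i2 v b (hole , (λ _ → v≉0) , (λ ()))
        (λ { fzero → e0 ; (fsuc fzero) → e1 ; (fsuc (fsuc fzero)) → P.refl }) no-root
      where
      avoidable = collision⇒avoidable (quadratic a1 a0) (quadratic-cong a1 a0) (zeroˡ _) collision
      v = proj₁ avoidable
      v≉0 = proj₁ (proj₂ avoidable)
      b = coeffs a0 a1 v
      no-root : ¬ HasRoot field' 2 b
      no-root (x , root) with x ≟ 0#
      ... | yes x≈0 = a0≉0 (trans (sym (ev-at-0 2 b)) (trans (ev-cong 2 b (sym x≈0)) root))
      ... | no x≉0 = proj₂ (proj₂ avoidable) (recip x)
          (zero-product (trans (sym (ev-reversed b x (recip x) (recip-inverse x≉0))) root) (*-nonzero x≉0 x≉0))

  -- Nora moves first: a₁ := 1.  After Wanda's end v, u ↦ u + v u² vanishes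
  -- at 0 and -1/v, so Nora can choose the other end without a root.
  noraWins : Wins Nora Nora start
  noraWins = myMove P.refl i1 1# (legal-middle {pos = start} 1# P.refl (λ ()) (λ ()))
               (theirMove (λ ()) (hole⇒incomplete i0 P.refl) answer)
    where
    answer : ∀ j v → Legal (set start i1 1#) j v → Wins Nora Nora (set (set start i1 1#) j v)
    answer fzero v (_ , _ , v≉0) =
      noraChoosesLeading P.refl P.refl P.refl (v≉0 P.refl) (quadratic-collision 1# v 1≉0 (v≉0 P.refl))
    answer (fsuc (fsuc fzero)) v (_ , v≉0 , _) =
      noraChoosesConstant P.refl P.refl P.refl (quadratic-collision 1# v 1≉0 (v≉0 P.refl))
    answer (fsuc fzero) _ legal = ⊥-elim (chosen⇒illegal {pos = set start i1 1#} P.refl legal)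

theorem9p1 : ∀ {c ℓ : Level} {q : ℕ} (F : FiniteField c ℓ q) (d : ℕ) → 2 ≤ d →
    (playerI : Player) →
    ((4 ≤ d ⊎ d ≡ 2) →
      Game.HasWinningStrategy (FiniteField.field' F) d (lastPlayer playerI d) playerI)
    × ((d ≡ 3) → HasCharacteristic (FiniteField.field' F) 3 →
      Game.HasWinningStrategy (FiniteField.field' F) d Wanda playerI)
    × ((d ≡ 3) → ¬ HasCharacteristic (FiniteField.field' F) 3 →
      Game.HasWinningStrategy (FiniteField.field' F) d (lastPlayer playerI d) playerI)
theorem9p1 F d _ playerI = part1 playerI , part2 playerI , part3 playerI
  where
  open FieldFacts F using (field'; char3⇒3≈0; 3≈0⇒char3)
  part1 : ∀ p → (4 ≤ d ⊎ d ≡ 2) → Game.HasWinningStrategy field' d (lastPlayer p d) p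
  part1 p (inj₁ 4≤d) = last-mover-wins-≥4 F d 4≤d p
  part1 Wanda (inj₂ P.refl) = DegreeTwo.wandaWins F
  part1 Nora (inj₂ P.refl) = DegreeTwo.noraWins F
  part2 : ∀ p → d ≡ 3 → HasCharacteristic field' 3 → Game.HasWinningStrategy field' d Wanda p
  part2 Wanda P.refl char3 = DegreeThree.WandaFirstChar3.wandaWins F (char3⇒3≈0 char3)
  part2 Nora P.refl _ = DegreeThree.Pairing.wandaWins F
  part3 : ∀ p → d ≡ 3 → ¬ HasCharacteristic field' 3 → Game.HasWinningStrategy field' d (lastPlayer p d) p
  part3 Wanda P.refl ¬char3 = DegreeThree.NoraLast.noraWins F (λ 3≈0 → ¬char3 (3≈0⇒char3 3≈0))
  part3 Nora P.refl _ = DegreeThree.Pairing.wandaWins F
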